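{- Let $k\ge 1$. Define $a(n)=\binom{n}{\lfloor n/2\rfloor}$ for $0\le n\le 2k$ and $a(2k+1)=\binom{2k+1}{k}-1$. Then $$L_{k+1}(1,-x^2)=\det\begin{pmatrix} a(0)&a(1)&\cdots&a(k)&x^{k+1}\\ a(1)&a(2)&\cdots&a(k+1)&x^{k}\\ \vdots&\vdots&\ddots&\vdots&\vdots\\ a(k)&a(k+1)&\cdots&a(2k)&x\\ a(k+1)&a(k+2)&\cdots&a(2k+1)&1\end{pmatrix},$$ i.e. the $(k+2)\times(k+2)$ matrix whose row $i$ ($0\le i\le k+1$) is $(a(i),a(i+1),\dots,a(i+k),x^{k+1-i})$.
   Context: The Lucas polynomials are $L_0(x,s)=2$ and, for $n\ge 1$, $L_n(x,s)=\sum_{j=0}^{\lfloor n/2\rfloor}\binom{n-j}{j}\frac{n}{n-j}s^jx^{n-2j}$; they satisfy $L_n=xL_{n-1}+sL_{n-2}$ with $L_1(x,s)=x$. (Here $a(2k+1)=\binom{2k+1}{k}-1$ is the number of $U/D$ lattice paths of length $2k+1$ from $(0,0)$ ending at height $0$ or $-1$ within the strip $-k\le y\le k$.) -}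

module Defs where

open import Level using (Level)
open import Algebra.Bundles using (CommutativeRing)
open import Data.Nat as ℕ using (ℕ; zero; suc; _∸_; ⌊_/2⌋; _<ᵇ_)
open import Data.Nat.DivMod using (_/_)
open import Data.Nat.Combinatorics using (_C_)
open import Data.Fin using (Fin; toℕ; punchIn)
open import Data.Bool using (if_then_else_)

-- exact-division helper: natural-number quotient, with the (never used) convention m ÷ 0 = 0
_÷_ : ℕ → ℕ → ℕ
m ÷ zero = 0
m ÷ suc d = m / suc d

aSeq : ℕ → ℕ → ℕ
aSeq k n = if n ℕ.≡ᵇ suc (k ℕ.+ k) then (suc (k ℕ.+ k) C k) ∸ 1 else (n C ⌊ n /2⌋)

module _ {c ℓ : Level} (R : CommutativeRing c ℓ) where
  open CommutativeRing R

  fromℕ : ℕ → Carrier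
  fromℕ zero = 0#
  fromℕ (suc n) = 1# + fromℕ n

  pow : Carrier → ℕ → Carrier
  pow x zero = 1#
  pow x (suc n) = x * pow x n

  sumFin : (n : ℕ) → (Fin n → Carrier) → Carrier
  sumFin zero f = 0#
  sumFin (suc n) f = f Fin.zero + sumFin n (λ i → f (Fin.suc i))

  det : (n : ℕ) → (Fin n → Fin n → Carrier) → Carrier
  det zero M = 1#
  det (suc n) M =
    sumFin (suc n) (λ j → pow (- 1#) (toℕ j) * (M Fin.zero j
                     * det n (λ i j' → M (Fin.suc i) (punchIn j j'))))

  -- Lucas polynomials L_n(x,s), evaluated in R:
  -- L_0 = 2,  L_n = Σ_{j=0}^{⌊n/2⌋} C(n-j,j) n/(n-j) s^j x^{n-2j}  (n ≥ 1)
  Lucas : ℕ → Carrier → Carrier → Carrier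
  Lucas zero x s = 1# + 1#
  Lucas (suc m) x s =
    sumFin (suc ⌊ suc m /2⌋) (λ j →
      fromℕ ((suc m ℕ.* ((suc m ∸ toℕ j) C toℕ j)) ÷ (suc m ∸ toℕ j))
        * (pow s (toℕ j) * pow x (suc m ∸ (toℕ j ℕ.+ toℕ j))))

  hankel : (k : ℕ) → Carrier → Fin (suc (suc k)) → Fin (suc (suc k)) → Carrier
  hankel k x i j =
    if toℕ j <ᵇ suc k then fromℕ (aSeq k (toℕ i ℕ.+ toℕ j))
                      else pow x (suc k ∸ toℕ i)

module Submission where

open import Defs
open import Algebra.Bundles using (CommutativeRing)
open import Data.Nat using (ℕ; suc; _≤_)
open import Level using (Level)
open import Data.Nat using (zero; _<_; z≤n; s≤s; ⌊_/2⌋; _∸_; _≟_; _<ᵇ_; _≡ᵇ_)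
import Data.Nat as ℕ
import Data.Nat.Properties as ℕₚ
open import Data.Bool using (true; false; if_then_else_)
open import Data.Fin using (Fin; toℕ; punchIn)
import Data.Fin as Fin
open import Data.Fin.Properties using (toℕ<n)
open import Data.Sum using (_⊎_; inj₁; inj₂)
open import Relation.Binary.Definitions using (tri<; tri≈; tri>)
open import Relation.Binary.PropositionalEquality as ≡ using (_≡_; _≢_)
open import Relation.Nullary using (Dec; yes; no; contradiction)
import Algebra.Solver.Ring.NaturalCoefficients.Default as SemiringSolver

{-
Let J be the adjacency matrix of the half-line 0 − 1 − 2 − ⋯ with a loop at 0, and vᵢ = Jⁱe₀, a
lower unitriangular family. Then (vᵢ)₀ = C(i, ⌊i/2⌋), and as J is symmetric ⟨vᵢ, vⱼ⟩ = (vᵢ₊ⱼ)₀ = a(i + j).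
Hence unitriangular column operations turn the first k + 1 columns of the Hankel matrix into the
columns ((vᵢ)ₕ)ᵢ, h ≤ k, except at the corner a(2k + 1), which is matched by deleting the entry
(v_{k+1})_k = 1. The last column (x^{k+1−i})ᵢ equals Σₕ x^{k+1−h} ρₕ vₕ, where ρₕ₊₂ = ρₕ₊₁ − x² ρₕ,
ρ₀ = 1, ρ₁ = 1 − x; subtracting that combination leaves a triangular matrix whose only non-unit
diagonal entry is ρ_{k+1} + x ρₖ. In terms of the Fibonacci polynomials Fₙ of s = −x² this is
F_{k+2} + s Fₖ = L_{k+1}(1, s).
-}

module _ where
  open import Data.Nat using (_+_; _*_)
  open import Data.Nat.Properties
  open import Data.Nat.Combinatorics using (_C_; nCk+nC[k+1]≡[n+1]C[k+1]; nCk≡nC[n∸k])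
  open import Data.Nat.DivMod using (_/_; m*n/n≡m)
  open import Data.Nat.Tactic.RingSolver using (solve-∀)
  open import Data.Product using (∃; _,_)
  open import Relation.Binary.PropositionalEquality

  binom : ℕ → ℕ → ℕ
  binom n       zero    = 1
  binom zero    (suc k) = 0
  binom (suc n) (suc k) = binom n k + binom n (suc k)

  binom≡C : ∀ n k → binom n k ≡ n C k
  binom≡C n       zero    = refl
  binom≡C zero    (suc k) = refl
  binom≡C (suc n) (suc k) =
    trans (cong₂ _+_ (binom≡C n k) (binom≡C n (suc k))) (nCk+nC[k+1]≡[n+1]C[k+1] n k)

  n<k⇒binom≡0 : ∀ {n k} → n < k → binom n k ≡ 0
  n<k⇒binom≡0 {zero}  {suc k} _         = refl
  n<k⇒binom≡0 {suc n} {suc k} (s≤s n<k) =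
    cong₂ _+_ (n<k⇒binom≡0 n<k) (n<k⇒binom≡0 (m<n⇒m<1+n n<k))

  binom-1 : ∀ n → binom n 1 ≡ n
  binom-1 zero    = refl
  binom-1 (suc n) = cong suc (binom-1 n)

  binom-absorb : ∀ n k → suc k * binom (suc n) (suc k) ≡ suc n * binom n k
  binom-absorb zero    zero    = refl
  binom-absorb zero    (suc k) =
    trans (cong (suc (suc k) *_) (n<k⇒binom≡0 {1} {suc (suc k)} (s≤s (s≤s z≤n)))) (*-zeroʳ (suc (suc k)))
  binom-absorb (suc n) zero    = cong suc (trans (+-identityʳ _) (trans (cong suc (binom-1 n)) (sym (*-identityʳ _))))
  binom-absorb (suc n) (suc k) = begin
      suc (suc k) * (b + binom (suc n) (suc (suc k)))
    ≡⟨ *-distribˡ-+ (suc (suc k)) b _ ⟩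
      (b + suc k * b) + suc (suc k) * binom (suc n) (suc (suc k))
    ≡⟨ cong₂ (λ u v → (b + u) + v) (binom-absorb n k) (binom-absorb n (suc k)) ⟩
      (b + suc n * binom n k) + suc n * binom n (suc k)
    ≡⟨ +-assoc b _ _ ⟩
      b + (suc n * binom n k + suc n * binom n (suc k))
    ≡⟨ cong (b +_) (*-distribˡ-+ (suc n) (binom n k) _) ⟨
      b + suc n * b
    ∎
    where
      open ≡-Reasoning
      b = binom (suc n) (suc k)

  binom-middle : ∀ m → binom (suc (m + m)) m ≡ binom (suc (m + m)) (suc m)
  binom-middle m = begin
      binom (suc (m + m)) m
    ≡⟨ binom≡C _ m ⟩
      suc (m + m) C m
    ≡⟨ nCk≡nC[n∸k] (m≤n⇒m≤1+n (m≤m+n m m)) ⟩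
      suc (m + m) C (suc (m + m) ∸ m)
    ≡⟨ cong (suc (m + m) C_) (trans (+-∸-assoc 1 (m≤m+n m m)) (cong suc (m+n∸m≡n m m))) ⟩
      suc (m + m) C suc m
    ≡⟨ binom≡C _ (suc m) ⟨
      binom (suc (m + m)) (suc m)
    ∎
    where open ≡-Reasoning

  -- (Jⁱe₀)ₕ: the ±1 walks of length i from 0 to h, where a down-step at 0 stays put
  paths : ℕ → ℕ → ℕ
  paths zero    zero    = 1
  paths zero    (suc h) = 0
  paths (suc i) zero    = paths i 0 + paths i 1
  paths (suc i) (suc h) = paths i h + paths i (suc (suc h))

  i<h⇒paths≡0 : ∀ {i h} → i < h → paths i h ≡ 0
  i<h⇒paths≡0 {zero}  {suc h} _         = refl
  i<h⇒paths≡0 {suc i} {suc h} (s≤s i<h) =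
    cong₂ _+_ (i<h⇒paths≡0 i<h) (i<h⇒paths≡0 (m<n⇒m<1+n (m<n⇒m<1+n i<h)))

  paths-diag : ∀ i → paths i i ≡ 1
  paths-diag zero    = refl
  paths-diag (suc i) = cong₂ _+_ (paths-diag i) (i<h⇒paths≡0 (m<n⇒m<1+n (n<1+n i)))

  paths-subdiag : ∀ i → paths (suc i) i ≡ 1
  paths-subdiag zero    = refl
  paths-subdiag (suc i) = cong₂ _+_ (paths-subdiag i) (i<h⇒paths≡0 (n<1+n (suc i)))

  1≤paths-0 : ∀ i → 1 ≤ paths i 0
  1≤paths-0 zero    = s≤s z≤n
  1≤paths-0 (suc i) = ≤-trans (1≤paths-0 i) (m≤m+n _ _)

  ⌊1+m+m/2⌋≡m : ∀ m → ⌊ suc (m + m) /2⌋ ≡ m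
  ⌊1+m+m/2⌋≡m zero    = refl
  ⌊1+m+m/2⌋≡m (suc m) = cong suc (trans (cong ⌊_/2⌋ (+-suc m m)) (⌊1+m+m/2⌋≡m m))

  even⊎odd : ∀ n → ∃ λ m → n ≡ m + m ⊎ n ≡ suc (m + m)
  even⊎odd zero    = 0 , inj₁ refl
  even⊎odd (suc n) with even⊎odd n
  ... | m , inj₁ e = m , inj₂ (cong suc e)
  ... | m , inj₂ e = suc m , inj₁ (cong suc (trans e (sym (+-suc m m))))

  binom-halves : ∀ n → binom (suc n) ⌊ suc n /2⌋ ≡ binom (suc n) (suc ⌊ n /2⌋)
  binom-halves n with even⊎odd n
  ... | m , inj₁ refl = trans (cong (binom (suc (m + m))) (⌊1+m+m/2⌋≡m m))
                          (trans (binom-middle m) (cong (λ t → binom (suc (m + m)) (suc t)) (n≡⌊n+n/2⌋ m)))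
  ... | m , inj₂ refl = cong (λ t → binom (suc (suc (m + m))) (suc t))
                          (trans (sym (n≡⌊n+n/2⌋ m)) (sym (⌊1+m+m/2⌋≡m m)))

  paths-closed : ∀ e h → paths (h + e) h ≡ binom (h + e) ⌊ e /2⌋
  paths-closed zero          zero    = refl
  paths-closed (suc zero)    zero    = refl
  paths-closed (suc (suc e)) zero    = begin
      paths (suc e) 0 + paths (suc e) 1
    ≡⟨ cong₂ _+_ (paths-closed (suc e) 0) (paths-closed e 1) ⟩
      binom (suc e) ⌊ suc e /2⌋ + binom (suc e) ⌊ e /2⌋
    ≡⟨ cong (_+ binom (suc e) ⌊ e /2⌋) (binom-halves e) ⟩
      binom (suc e) (suc ⌊ e /2⌋) + binom (suc e) ⌊ e /2⌋
    ≡⟨ +-comm (binom (suc e) (suc ⌊ e /2⌋)) _ ⟩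
      binom (suc (suc e)) (suc ⌊ e /2⌋)
    ∎
    where open ≡-Reasoning
  paths-closed zero          (suc h) =
    cong₂ _+_ (paths-closed 0 h) (i<h⇒paths≡0 (s≤s (≤-trans (≤-reflexive (+-identityʳ h)) (n≤1+n h))))
  paths-closed (suc zero)    (suc h) =
    cong₂ _+_ (paths-closed 1 h) (i<h⇒paths≡0 (s≤s (≤-reflexive (+-comm h 1))))
  paths-closed (suc (suc e)) (suc h) =
    trans (cong₂ _+_ (paths-closed (suc (suc e)) h) far) (+-comm (binom (h + suc (suc e)) (suc ⌊ e /2⌋)) _)
    where
      h+2+e : h + suc (suc e) ≡ suc (suc h) + e
      h+2+e = trans (+-suc h (suc e)) (cong suc (+-suc h e))
      far : paths (h + suc (suc e)) (suc (suc h)) ≡ binom (h + suc (suc e)) ⌊ e /2⌋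
      far = trans (cong (λ t → paths t (suc (suc h))) h+2+e)
                  (trans (paths-closed e (suc (suc h))) (cong (λ t → binom t ⌊ e /2⌋) (sym h+2+e)))

  paths-0 : ∀ n → paths n 0 ≡ n C ⌊ n /2⌋
  paths-0 n = trans (paths-closed n 0) (binom≡C n ⌊ n /2⌋)

  lucasTail : ℕ → ℕ → ℕ
  lucasTail m zero    = 0
  lucasTail m (suc j) = binom (m ∸ suc j) j

  lucas-coeff : ∀ m j → j ≤ m →
                (suc m * ((suc m ∸ j) C j)) ÷ (suc m ∸ j) ≡ binom (suc m ∸ j) j + lucasTail m j
  lucas-coeff m j j≤m =
    subst (λ m → (suc m * ((suc m ∸ j) C j)) ÷ (suc m ∸ j) ≡ binom (suc m ∸ j) j + lucasTail m j)
          (m∸n+n≡m j≤m) (shifted (m ∸ j) j)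
    where
      open ≡-Reasoning
      exact : ∀ a j → (suc (a + j) * binom (suc a) j) / suc a ≡ binom (suc a) j + lucasTail (a + j) j
      exact a zero    = trans (cong (λ t → suc t * 1 / suc a) (+-identityʳ a)) (trans (cong (_/ suc a) (*-comm (suc a) 1)) (m*n/n≡m 1 (suc a)))
      exact a (suc j) = trans (cong (_/ suc a) quotient) (m*n/n≡m _ (suc a))
        where
          b = binom (suc a) (suc j)
          split : ∀ a j b → suc (a + suc j) * b ≡ suc j * b + suc a * b
          split = solve-∀
          merge : ∀ a c b → suc a * c + suc a * b ≡ (b + c) * suc a
          merge = solve-∀
          quotient : suc (a + suc j) * b ≡ (b + lucasTail (a + suc j) (suc j)) * suc a
          quotient = begin
              suc (a + suc j) * b
            ≡⟨ split a j b ⟩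
              suc j * b + suc a * b
            ≡⟨ cong (_+ suc a * b) (binom-absorb a j) ⟩
              suc a * binom a j + suc a * b
            ≡⟨ merge a (binom a j) b ⟩
              (b + binom a j) * suc a
            ≡⟨ cong (λ t → (b + binom t j) * suc a) (sym (m+n∸n≡m a (suc j))) ⟩
              (b + lucasTail (a + suc j) (suc j)) * suc a
            ∎
      shifted : ∀ a j → (suc (a + j) * ((suc (a + j) ∸ j) C j)) ÷ (suc (a + j) ∸ j)
                        ≡ binom (suc (a + j) ∸ j) j + lucasTail (a + j) j
      shifted a j rewrite m+n∸n≡m (suc a) j | sym (binom≡C (suc a) j) = exact a j

  binom-diagonal : ∀ N j → binom (suc N ∸ j) (suc j) ≡ binom (N ∸ j) (suc j) + binom (N ∸ j) j
  binom-diagonal N j = go N j j ≤-refl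
    where
      go : ∀ N j k → j ≤ k → binom (suc N ∸ j) (suc k) ≡ binom (N ∸ j) (suc k) + binom (N ∸ j) k
      go N       zero    k       _   = +-comm (binom N k) _
      go zero    (suc j) (suc k) _   rewrite 0∸n≡0 j = refl
      go (suc N) (suc j) k       j≤k = go N j k (≤-trans (n≤1+n j) j≤k)

  ⌊n/2⌋<j⇒n<j+j : ∀ n j → ⌊ n /2⌋ < j → n < j + j
  ⌊n/2⌋<j⇒n<j+j zero          (suc j) _         = s≤s z≤n
  ⌊n/2⌋<j⇒n<j+j (suc zero)    (suc j) _         = s≤s (subst (1 ≤_) (sym (+-suc j j)) (s≤s z≤n))
  ⌊n/2⌋<j⇒n<j+j (suc (suc n)) (suc j) (s≤s n<j) =
    subst (λ t → suc (suc n) < suc t) (sym (+-suc j j)) (s≤s (s≤s (⌊n/2⌋<j⇒n<j+j n j n<j)))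

  aSeq-last : ∀ k → aSeq k (suc (k + k)) ≡ suc (k + k) C k ∸ 1
  aSeq-last k with suc (k + k) ≡ᵇ suc (k + k) | ≡⇒≡ᵇ (suc (k + k)) (suc (k + k)) refl
  ... | true  | _ = refl
  ... | false | ()

  aSeq-other : ∀ k m → m ≢ suc (k + k) → aSeq k m ≡ m C ⌊ m /2⌋
  aSeq-other k m m≢2k+1 with m ≡ᵇ suc (k + k) | ≡ᵇ⇒≡ m (suc (k + k))
  ... | false | _ = refl
  ... | true  | m≡2k+1 = contradiction (m≡2k+1 _) m≢2k+1

  -- dropping the entry paths (k + 1) k = 1 accounts for the −1 in a(2k + 1)
  trimmedPaths : ℕ → ℕ → ℕ → ℕ
  trimmedPaths k i h with i ≟ suc k | h ≟ k
  ... | yes _ | yes _ = 0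
  ... | _     | _     = paths i h

  trimmedPaths-corner : ∀ k → trimmedPaths k (suc k) k ≡ 0
  trimmedPaths-corner k with suc k ≟ suc k | k ≟ k
  ... | yes _   | yes _ = refl
  ... | yes _   | no k≢k = contradiction refl k≢k
  ... | no k≢k  | _     = contradiction refl k≢k

  trimmedPaths-row : ∀ k i h → i ≢ suc k → trimmedPaths k i h ≡ paths i h
  trimmedPaths-row k i h i≢K with i ≟ suc k | h ≟ k
  ... | yes i≡K | _     = contradiction i≡K i≢K
  ... | no _    | _     = refl

  trimmedPaths-column : ∀ k i h → h ≢ k → trimmedPaths k i h ≡ paths i h
  trimmedPaths-column k i h h≢k with i ≟ suc k | h ≟ k
  ... | yes _ | yes h≡k = contradiction h≡k h≢k
  ... | yes _ | no _    = refl
  ... | no _  | _       = refl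

  trimmedPaths-upper : ∀ k i h → i < h → trimmedPaths k i h ≡ 0
  trimmedPaths-upper k i h i<h with i ≟ suc k | h ≟ k
  ... | yes _ | yes _ = refl
  ... | yes _ | no _  = i<h⇒paths≡0 i<h
  ... | no _  | _     = i<h⇒paths≡0 i<h

module Determinant {c ℓ : Level} (R : CommutativeRing c ℓ) where
  open import Data.Nat.Properties
    using (≤-refl; <-irrefl; <-trans; n<1+n; <⇒≤; ≤⇒≯; m≤n⇒m<n∨m≡n; <⇒<ᵇ; <ᵇ⇒<; ≡ᵇ⇒≡; ≡⇒≡ᵇ; suc-injective; <-cmp; m≤n+m)
  open CommutativeRing R hiding (zero)
  open import Algebra.Properties.Ring ring using (-1*x≈-x; -‿involutive; -0#≈0#; -‿distribˡ-*)
  open import Algebra.Properties.Group +-group using (inverseʳ-unique)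
  open import Relation.Binary.Reasoning.Setoid setoid
  open SemiringSolver commutativeSemiring using (solve; _:=_; _:+_; _:*_)

  ∑ : ℕ → (ℕ → Carrier) → Carrier
  ∑ zero    f = 0#
  ∑ (suc n) f = f 0 + ∑ n (λ i → f (suc i))

  sumFin≡∑ : ∀ n (f : ℕ → Carrier) → sumFin R n (λ j → f (toℕ j)) ≡ ∑ n f
  sumFin≡∑ zero    f = ≡.refl
  sumFin≡∑ (suc n) f = ≡.cong (f 0 +_) (sumFin≡∑ n (λ i → f (suc i)))

  sumFin-cong : ∀ n {f g : Fin n → Carrier} → (∀ j → f j ≈ g j) → sumFin R n f ≈ sumFin R n g
  sumFin-cong zero    e = refl
  sumFin-cong (suc n) e = +-cong (e Fin.zero) (sumFin-cong n (λ j → e (Fin.suc j)))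

  ∑-cong : ∀ n {f g : ℕ → Carrier} → (∀ i → i < n → f i ≈ g i) → ∑ n f ≈ ∑ n g
  ∑-cong zero    e = refl
  ∑-cong (suc n) e = +-cong (e 0 (s≤s z≤n)) (∑-cong n (λ i i<n → e (suc i) (s≤s i<n)))

  ∑-+ : ∀ n (f g : ℕ → Carrier) → ∑ n (λ i → f i + g i) ≈ ∑ n f + ∑ n g
  ∑-+ zero    f g = sym (+-identityˡ 0#)
  ∑-+ (suc n) f g = trans (+-congˡ (∑-+ n _ _))
    (solve 4 (λ a b c d → ((a :+ b) :+ (c :+ d)) := ((a :+ c) :+ (b :+ d))) refl _ _ _ _)

  ∑-*ˡ : ∀ n a (f : ℕ → Carrier) → ∑ n (λ i → a * f i) ≈ a * ∑ n f
  ∑-*ˡ zero    a f = sym (zeroʳ a)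
  ∑-*ˡ (suc n) a f = trans (+-congˡ (∑-*ˡ n a _)) (sym (distribˡ a _ _))

  ∑-zero : ∀ n {f : ℕ → Carrier} → (∀ i → i < n → f i ≈ 0#) → ∑ n f ≈ 0#
  ∑-zero zero    e = refl
  ∑-zero (suc n) e = trans (+-cong (e 0 (s≤s z≤n)) (∑-zero n (λ i i<n → e (suc i) (s≤s i<n)))) (+-identityˡ 0#)

  ∑-snoc : ∀ n (f : ℕ → Carrier) → ∑ (suc n) f ≈ ∑ n f + f n
  ∑-snoc zero    f = +-comm (f 0) 0#
  ∑-snoc (suc n) f = trans (+-congˡ (∑-snoc n (λ i → f (suc i)))) (sym (+-assoc _ _ _))

  ∑-extend : ∀ n d (f : ℕ → Carrier) → (∀ i → n ≤ i → f i ≈ 0#) → ∑ (n ℕ.+ d) f ≈ ∑ n f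
  ∑-extend zero    d f e = ∑-zero d (λ i _ → e i z≤n)
  ∑-extend (suc n) d f e = +-congˡ (∑-extend n d _ (λ i n≤i → e (suc i) (s≤s n≤i)))

  ∑-pair : ∀ n c (f : ℕ → Carrier) → suc c < n → f c + f (suc c) ≈ 0# →
           (∀ i → i < n → i ≢ c → i ≢ suc c → f i ≈ 0#) → ∑ n f ≈ 0#
  ∑-pair (suc (suc n)) zero    f _         cancel others = begin
      f 0 + (f 1 + ∑ n (λ i → f (suc (suc i))))
    ≈⟨ +-congˡ (+-congˡ (∑-zero n (λ i i<n → others (suc (suc i)) (s≤s (s≤s i<n)) (λ ()) (λ ())))) ⟩
      f 0 + (f 1 + 0#)
    ≈⟨ trans (+-congˡ (+-identityʳ _)) cancel ⟩
      0#
    ∎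
  ∑-pair (suc n)       (suc c) f (s≤s c<n) cancel others =
    trans (+-cong (others 0 (s≤s z≤n) (λ ()) (λ ()))
                  (∑-pair n c (λ i → f (suc i)) c<n cancel
                     (λ i i<n i≢c i≢1+c → others (suc i) (s≤s i<n) (λ e → i≢c (suc-injective e)) (λ e → i≢1+c (suc-injective e)))))
          (+-identityˡ 0#)

  ∏ : ℕ → (ℕ → Carrier) → Carrier
  ∏ zero    f = 1#
  ∏ (suc n) f = f 0 * ∏ n (λ i → f (suc i))

  ∏-last : ∀ n (f : ℕ → Carrier) → (∀ i → i < n → f i ≈ 1#) → ∏ (suc n) f ≈ f n
  ∏-last zero    f e = *-identityʳ _
  ∏-last (suc n) f e =
    trans (*-cong (e 0 (s≤s z≤n)) (∏-last n (λ i → f (suc i)) (λ i i<n → e (suc i) (s≤s i<n)))) (*-identityˡ _)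

  Matrix : Set c
  Matrix = ℕ → ℕ → Carrier

  det′ : ℕ → Matrix → Carrier
  det′ n M = det R n (λ i j → M (toℕ i) (toℕ j))

  det-cong : ∀ n {A B : Fin n → Fin n → Carrier} → (∀ i j → A i j ≈ B i j) → det R n A ≈ det R n B
  det-cong zero    e = refl
  det-cong (suc n) {A} {B} e = sumFin-cong (suc n) {expansion A} {expansion B} (λ j →
    *-congˡ (*-cong (e Fin.zero j) (det-cong n (λ i j′ → e (Fin.suc i) (punchIn j j′)))))
    where
      expansion : (Fin (suc n) → Fin (suc n) → Carrier) → Fin (suc n) → Carrier
      expansion M j = pow R (- 1#) (toℕ j) * (M Fin.zero j * det R n (λ i j′ → M (Fin.suc i) (punchIn j j′)))

  det′-cong : ∀ n {M M′ : Matrix} → (∀ i j → i < n → j < n → M i j ≈ M′ i j) → det′ n M ≈ det′ n M′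
  det′-cong n e = det-cong n (λ i j → e (toℕ i) (toℕ j) (toℕ<n i) (toℕ<n j))

  punchInℕ : ℕ → ℕ → ℕ
  punchInℕ zero    j       = suc j
  punchInℕ (suc i) zero    = zero
  punchInℕ (suc i) (suc j) = suc (punchInℕ i j)

  punchOutℕ : ℕ → ℕ → ℕ
  punchOutℕ zero    zero    = zero
  punchOutℕ zero    (suc j) = j
  punchOutℕ (suc i) zero    = zero
  punchOutℕ (suc i) (suc j) = suc (punchOutℕ i j)

  toℕ-punchIn : ∀ {n} (i : Fin (suc n)) (j : Fin n) → toℕ (punchIn i j) ≡ punchInℕ (toℕ i) (toℕ j)
  toℕ-punchIn Fin.zero    j           = ≡.refl
  toℕ-punchIn (Fin.suc i) Fin.zero    = ≡.refl
  toℕ-punchIn (Fin.suc i) (Fin.suc j) = ≡.cong suc (toℕ-punchIn i j)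

  punchInℕ-punchOutℕ : ∀ i j → i ≢ j → punchInℕ i (punchOutℕ i j) ≡ j
  punchInℕ-punchOutℕ zero    zero    i≢j = contradiction ≡.refl i≢j
  punchInℕ-punchOutℕ zero    (suc j) _   = ≡.refl
  punchInℕ-punchOutℕ (suc i) zero    _   = ≡.refl
  punchInℕ-punchOutℕ (suc i) (suc j) i≢j = ≡.cong suc (punchInℕ-punchOutℕ i j (λ e → i≢j (≡.cong suc e)))

  punchInℕ-injective : ∀ i j k → punchInℕ i j ≡ punchInℕ i k → j ≡ k
  punchInℕ-injective zero    j       k       e = suc-injective e
  punchInℕ-injective (suc i) zero    zero    e = ≡.refl
  punchInℕ-injective (suc i) (suc j) (suc k) e = ≡.cong suc (punchInℕ-injective i j k (suc-injective e))

  punchInℕᵢ≢i : ∀ i j → punchInℕ i j ≢ i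
  punchInℕᵢ≢i zero    j       ()
  punchInℕᵢ≢i (suc i) zero    ()
  punchInℕᵢ≢i (suc i) (suc j) e = punchInℕᵢ≢i i j (suc-injective e)

  punchInℕ≢ : ∀ i j k → i ≢ j → k ≢ punchOutℕ i j → punchInℕ i k ≢ j
  punchInℕ≢ i j k i≢j k≢ e = k≢ (punchInℕ-injective i k _ (≡.trans e (≡.sym (punchInℕ-punchOutℕ i j i≢j))))

  punchOutℕ-< : ∀ i j n → i ≢ j → i < suc n → j < suc n → punchOutℕ i j < n
  punchOutℕ-< zero    zero    n       i≢j _         _         = contradiction ≡.refl i≢j
  punchOutℕ-< zero    (suc j) n       _   _         (s≤s j<n) = j<n
  punchOutℕ-< (suc i) zero    zero    _   (s≤s ())  _
  punchOutℕ-< (suc i) zero    (suc n) _   _         _         = s≤s z≤n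
  punchOutℕ-< (suc i) (suc j) (suc n) i≢j (s≤s i<n) (s≤s j<n) =
    s≤s (punchOutℕ-< i j n (λ e → i≢j (≡.cong suc e)) i<n j<n)

  punchOutℕ-suc : ∀ i j → i ≢ j → i ≢ suc j → punchOutℕ i (suc j) ≡ suc (punchOutℕ i j)
  punchOutℕ-suc zero          zero    i≢j _    = contradiction ≡.refl i≢j
  punchOutℕ-suc zero          (suc j) _   _    = ≡.refl
  punchOutℕ-suc (suc zero)    zero    _   i≢1  = contradiction ≡.refl i≢1
  punchOutℕ-suc (suc (suc i)) zero    _   _    = ≡.refl
  punchOutℕ-suc (suc i)       (suc j) i≢j i≢1+j =
    ≡.cong suc (punchOutℕ-suc i j (λ e → i≢j (≡.cong suc e)) (λ e → i≢1+j (≡.cong suc e)))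

  minor : ℕ → Matrix → Matrix
  minor j M i j′ = M (suc i) (punchInℕ j j′)

  sgn : ℕ → Carrier
  sgn j = pow R (- 1#) j

  det′-expand : ∀ n (M : Matrix) → det′ (suc n) M ≈ ∑ (suc n) (λ j → sgn j * (M 0 j * det′ n (minor j M)))
  det′-expand n M = trans
    (sumFin-cong (suc n)
       {λ j → sgn (toℕ j) * (M 0 (toℕ j) * det R n (λ i j′ → M (suc (toℕ i)) (toℕ (punchIn j j′))))}
       {λ j → sgn (toℕ j) * (M 0 (toℕ j) * det′ n (minor (toℕ j) M))}
       (λ j → *-congˡ (*-congˡ (det-cong n (λ i j′ →
      reflexive (≡.cong (M (suc (toℕ i))) (toℕ-punchIn j j′)))))))
    (reflexive (sumFin≡∑ (suc n) (λ j → sgn j * (M 0 j * det′ n (minor j M)))))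

  det′-linear : ∀ n c → c < n → (A B C : Matrix) (s : Carrier) →
                (∀ i j → j ≢ c → A i j ≈ B i j) → (∀ i j → j ≢ c → A i j ≈ C i j) →
                (∀ i → A i c ≈ B i c + s * C i c) → det′ n A ≈ det′ n B + s * det′ n C
  det′-linear (suc n) c c<n A B C s A≈B A≈C A≈B+sC = begin
      det′ (suc n) A
    ≈⟨ det′-expand n A ⟩
      ∑ (suc n) (λ j → sgn j * (A 0 j * det′ n (minor j A)))
    ≈⟨ ∑-cong (suc n) term ⟩
      ∑ (suc n) (λ j → expansion B j + s * expansion C j)
    ≈⟨ ∑-+ (suc n) (expansion B) (λ j → s * expansion C j) ⟩
      ∑ (suc n) (expansion B) + ∑ (suc n) (λ j → s * expansion C j)
    ≈⟨ +-cong (sym (det′-expand n B)) (trans (∑-*ˡ (suc n) s (expansion C)) (*-congˡ (sym (det′-expand n C)))) ⟩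
      det′ (suc n) B + s * det′ (suc n) C
    ∎
    where
      expansion : Matrix → ℕ → Carrier
      expansion M j = sgn j * (M 0 j * det′ n (minor j M))

      term : ∀ j → j < suc n → expansion A j ≈ expansion B j + s * expansion C j
      term j j<n with j ≟ c
      ... | yes ≡.refl = begin
          sgn j * (A 0 j * det′ n (minor j A))
        ≈⟨ *-congˡ (*-cong (A≈B+sC 0) (det′-cong n (λ i j′ _ _ → A≈B (suc i) (punchInℕ j j′) (punchInℕᵢ≢i j j′)))) ⟩
          sgn j * ((B 0 j + s * C 0 j) * det′ n (minor j B))
        ≈⟨ solve 5 (λ g b c s d → (g :* ((b :+ s :* c) :* d)) := (g :* (b :* d) :+ s :* (g :* (c :* d)))) refl _ _ _ _ _ ⟩
          expansion B j + s * (sgn j * (C 0 j * det′ n (minor j B)))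
        ≈⟨ +-congˡ (*-congˡ (*-congˡ (*-congˡ (det′-cong n (λ i j′ _ _ →
             trans (sym (A≈B (suc i) (punchInℕ j j′) (punchInℕᵢ≢i j j′))) (A≈C (suc i) (punchInℕ j j′) (punchInℕᵢ≢i j j′))))))) ⟩
          expansion B j + s * expansion C j
        ∎
      ... | no j≢c = begin
          sgn j * (A 0 j * det′ n (minor j A))
        ≈⟨ *-congˡ (*-congˡ (det′-linear n (punchOutℕ j c) (punchOutℕ-< j c n j≢c j<n c<n) (minor j A) (minor j B) (minor j C) s
              (λ i j′ ne → A≈B (suc i) (punchInℕ j j′) (punchInℕ≢ j c j′ j≢c ne))
              (λ i j′ ne → A≈C (suc i) (punchInℕ j j′) (punchInℕ≢ j c j′ j≢c ne))
              (λ i → ≡.subst (λ t → A (suc i) t ≈ B (suc i) t + s * C (suc i) t)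
                             (≡.sym (punchInℕ-punchOutℕ j c j≢c)) (A≈B+sC (suc i))))) ⟩
          sgn j * (A 0 j * (det′ n (minor j B) + s * det′ n (minor j C)))
        ≈⟨ solve 5 (λ g a x s y → (g :* (a :* (x :+ s :* y))) := (g :* (a :* x) :+ s :* (g :* (a :* y)))) refl _ _ _ _ _ ⟩
          sgn j * (A 0 j * det′ n (minor j B)) + s * (sgn j * (A 0 j * det′ n (minor j C)))
        ≈⟨ +-cong (*-congˡ (*-congʳ (A≈B 0 j j≢c))) (*-congˡ (*-congˡ (*-congʳ (A≈C 0 j j≢c)))) ⟩
          expansion B j + s * expansion C j
        ∎

  punchInℕ-adjacent : ∀ c j → j ≢ c → punchInℕ c j ≡ punchInℕ (suc c) j
  punchInℕ-adjacent zero    zero    j≢c = contradiction ≡.refl j≢c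
  punchInℕ-adjacent zero    (suc j) _   = ≡.refl
  punchInℕ-adjacent (suc c) zero    _   = ≡.refl
  punchInℕ-adjacent (suc c) (suc j) j≢c = ≡.cong suc (punchInℕ-adjacent c j (λ e → j≢c (≡.cong suc e)))

  punchInℕ-self : ∀ c → punchInℕ c c ≡ suc c
  punchInℕ-self zero    = ≡.refl
  punchInℕ-self (suc c) = ≡.cong suc (punchInℕ-self c)

  punchInℕ-suc-self : ∀ c → punchInℕ (suc c) c ≡ c
  punchInℕ-suc-self zero    = ≡.refl
  punchInℕ-suc-self (suc c) = ≡.cong suc (punchInℕ-suc-self c)

  det′-adjacentEqual : ∀ n c (A : Matrix) → suc c < n → (∀ i → A i c ≈ A i (suc c)) → det′ n A ≈ 0#
  det′-adjacentEqual (suc n) c A 1+c<n eq = trans (det′-expand n A) (∑-pair (suc n) c (expansion A) 1+c<n cancel others)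
    where
      expansion : Matrix → ℕ → Carrier
      expansion M j = sgn j * (M 0 j * det′ n (minor j M))
      same-minor : det′ n (minor c A) ≈ det′ n (minor (suc c) A)
      same-minor = det′-cong n (λ i j _ _ → entry i j)
        where
          entry : ∀ i j → A (suc i) (punchInℕ c j) ≈ A (suc i) (punchInℕ (suc c) j)
          entry i j with j ≟ c
          ... | yes ≡.refl = trans (reflexive (≡.cong (A (suc i)) (punchInℕ-self j)))
                               (trans (sym (eq (suc i))) (reflexive (≡.cong (A (suc i)) (≡.sym (punchInℕ-suc-self j)))))
          ... | no j≢c = reflexive (≡.cong (A (suc i)) (punchInℕ-adjacent c j j≢c))
      cancel : expansion A c + expansion A (suc c) ≈ 0#
      cancel = begin
          sgn c * (A 0 c * det′ n (minor c A)) + (- 1# * sgn c) * (A 0 (suc c) * det′ n (minor (suc c) A))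
        ≈⟨ +-congˡ (*-cong (-1*x≈-x _) (*-cong (sym (eq 0)) (sym same-minor))) ⟩
          sgn c * (A 0 c * det′ n (minor c A)) + (- sgn c) * (A 0 c * det′ n (minor c A))
        ≈⟨ trans (+-congˡ (sym (-‿distribˡ-* _ _))) (-‿inverseʳ _) ⟩
          0#
        ∎
      others : ∀ j → j < suc n → j ≢ c → j ≢ suc c → expansion A j ≈ 0#
      others j j<n j≢c j≢1+c =
        trans (*-congˡ (*-congˡ (det′-adjacentEqual n (punchOutℕ j c) (minor j A) bound adjacent)))
              (trans (*-congˡ (zeroʳ _)) (zeroʳ _))
        where
          next : punchOutℕ j (suc c) ≡ suc (punchOutℕ j c)
          next = punchOutℕ-suc j c j≢c j≢1+c
          bound : suc (punchOutℕ j c) < n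
          bound = ≡.subst (_< n) next (punchOutℕ-< j (suc c) n j≢1+c j<n 1+c<n)
          adjacent : ∀ i → minor j A i (punchOutℕ j c) ≈ minor j A i (suc (punchOutℕ j c))
          adjacent i = begin
              A (suc i) (punchInℕ j (punchOutℕ j c))  ≡⟨ ≡.cong (A (suc i)) (punchInℕ-punchOutℕ j c j≢c) ⟩
              A (suc i) c                              ≈⟨ eq (suc i) ⟩
              A (suc i) (suc c)                        ≡⟨ ≡.cong (A (suc i)) (punchInℕ-punchOutℕ j (suc c) j≢1+c) ⟨
              A (suc i) (punchInℕ j (punchOutℕ j (suc c))) ≡⟨ ≡.cong (λ t → A (suc i) (punchInℕ j t)) next ⟩
              A (suc i) (punchInℕ j (suc (punchOutℕ j c)))
            ∎

  setCol : ℕ → (ℕ → Carrier) → Matrix → Matrix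
  setCol c u A i j = if j ≡ᵇ c then u i else A i j

  setCol-same : ∀ c u A i → setCol c u A i c ≡ u i
  setCol-same c u A i with c ≡ᵇ c | ≡⇒≡ᵇ c c ≡.refl
  ... | true  | _ = ≡.refl
  ... | false | ()

  setCol-other : ∀ c j u A i → j ≢ c → setCol c u A i j ≡ A i j
  setCol-other c j u A i j≢c with j ≡ᵇ c | ≡ᵇ⇒≡ j c
  ... | false | _   = ≡.refl
  ... | true  | j≡c = contradiction (j≡c _) j≢c

  setCol-comm : ∀ c d p q A i j → c ≢ d → setCol c p (setCol d q A) i j ≡ setCol d q (setCol c p A) i j
  setCol-comm c d p q A i j c≢d with j ≟ c | j ≟ d
  ... | yes ≡.refl | _          = ≡.trans (setCol-same j p (setCol d q A) i)
                                    (≡.sym (≡.trans (setCol-other d j q (setCol j p A) i c≢d) (setCol-same j p A i)))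
  ... | no j≢c     | yes ≡.refl = ≡.trans (setCol-other c j p (setCol j q A) i j≢c)
                                    (≡.trans (setCol-same j q A i) (≡.sym (setCol-same j q (setCol c p A) i)))
  ... | no j≢c     | no j≢d     = ≡.trans (setCol-other c j p (setCol d q A) i j≢c)
                                    (≡.trans (setCol-other d j q A i j≢d)
                                      (≡.sym (≡.trans (setCol-other d j q (setCol c p A) i j≢d) (setCol-other c j p A i j≢c))))

  det′-additive : ∀ n c → c < n → (A : Matrix) (p q : ℕ → Carrier) →
                  det′ n (setCol c (λ i → p i + q i) A) ≈ det′ n (setCol c p A) + det′ n (setCol c q A)
  det′-additive n c c<n A p q = trans
    (det′-linear n c c<n (setCol c (λ i → p i + q i) A) (setCol c p A) (setCol c q A) 1# (unchanged p) (unchanged q) (λ i → begin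
        setCol c (λ i → p i + q i) A i c  ≡⟨ setCol-same c (λ i → p i + q i) A i ⟩
        p i + q i                         ≈⟨ +-cong (reflexive (≡.sym (setCol-same c p A i))) (sym (trans (*-identityˡ _) (reflexive (setCol-same c q A i)))) ⟩
        setCol c p A i c + 1# * setCol c q A i c ∎))
    (+-congˡ (*-identityˡ _))
    where
      unchanged : ∀ r i j → j ≢ c → setCol c (λ i → p i + q i) A i j ≈ setCol c r A i j
      unchanged r i j j≢c = reflexive (≡.trans (setCol-other c j (λ i → p i + q i) A i j≢c) (≡.sym (setCol-other c j r A i j≢c)))

  transposeℕ : ℕ → ℕ → ℕ
  transposeℕ zero    zero          = 1
  transposeℕ zero    (suc zero)    = 0
  transposeℕ zero    (suc (suc j)) = suc (suc j)
  transposeℕ (suc c) zero          = zero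
  transposeℕ (suc c) (suc j)       = suc (transposeℕ c j)

  transposeℕ-self : ∀ c → transposeℕ c c ≡ suc c
  transposeℕ-self zero    = ≡.refl
  transposeℕ-self (suc c) = ≡.cong suc (transposeℕ-self c)

  transposeℕ-suc : ∀ c → transposeℕ c (suc c) ≡ c
  transposeℕ-suc zero    = ≡.refl
  transposeℕ-suc (suc c) = ≡.cong suc (transposeℕ-suc c)

  transposeℕ-other : ∀ c j → j ≢ c → j ≢ suc c → transposeℕ c j ≡ j
  transposeℕ-other zero    zero          j≢c _     = contradiction ≡.refl j≢c
  transposeℕ-other zero    (suc zero)    _   j≢1+c = contradiction ≡.refl j≢1+c
  transposeℕ-other zero    (suc (suc j)) _   _     = ≡.refl
  transposeℕ-other (suc c) zero          _   _     = ≡.refl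
  transposeℕ-other (suc c) (suc j)       j≢c j≢1+c =
    ≡.cong suc (transposeℕ-other c j (λ e → j≢c (≡.cong suc e)) (λ e → j≢1+c (≡.cong suc e)))

  det′-swapAdjacent : ∀ n c (A : Matrix) → suc c < n → det′ n (λ i j → A i (transposeℕ c j)) ≈ - det′ n A
  det′-swapAdjacent n c A 1+c<n = inverseʳ-unique (det′ n A) _ (begin
      det′ n A + det′ n (λ i j → A i (transposeℕ c j))
    ≈⟨ +-cong (sym (reassemble u w (λ _ → ≡.refl) (λ _ → ≡.refl) (λ _ _ _ _ → ≡.refl)))
              (sym (reassemble w u (λ i → ≡.cong (A i) (transposeℕ-self c)) (λ i → ≡.cong (A i) (transposeℕ-suc c))
                                   (λ i j j≢c j≢1+c → ≡.cong (A i) (transposeℕ-other c j j≢c j≢1+c)))) ⟩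
      f u w + f w u
    ≈⟨ sym (+-cong (trans (+-congʳ (alternating u)) (+-identityˡ _)) (trans (+-congˡ (alternating w)) (+-identityʳ _))) ⟩
      (f u u + f u w) + (f w u + f w w)
    ≈⟨ sym (+-cong (additiveʳ u u w) (additiveʳ w u w)) ⟩
      f u u+w + f w u+w
    ≈⟨ sym (additiveˡ u w u+w) ⟩
      f u+w u+w
    ≈⟨ alternating u+w ⟩
      0#
    ∎)
    where
      u w u+w : ℕ → Carrier
      u i = A i c
      w i = A i (suc c)
      u+w i = u i + w i
      inner : (ℕ → Carrier) → Matrix
      inner q = setCol (suc c) q A
      f : (ℕ → Carrier) → (ℕ → Carrier) → Carrier
      f p q = det′ n (setCol c p (inner q))
      alternating : ∀ p → f p p ≈ 0#
      alternating p = det′-adjacentEqual n c (setCol c p (inner p)) 1+c<n (λ i →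
        reflexive (≡.trans (setCol-same c p (inner p) i) (≡.sym (≡.trans (setCol-other c (suc c) p (inner p) i (λ ())) (setCol-same (suc c) p A i)))))
      additiveˡ : ∀ p p′ q → f (λ i → p i + p′ i) q ≈ f p q + f p′ q
      additiveˡ p p′ q = det′-additive n c (<-trans (n<1+n c) 1+c<n) (inner q) p p′
      additiveʳ : ∀ p q q′ → f p (λ i → q i + q′ i) ≈ f p q + f p q′
      additiveʳ p q q′ = trans (commuted p (λ i → q i + q′ i))
        (trans (det′-additive n (suc c) 1+c<n (setCol c p A) q q′) (sym (+-cong (commuted p q) (commuted p q′))))
        where
          commuted : ∀ p q → f p q ≈ det′ n (setCol (suc c) q (setCol c p A))
          commuted p q = det′-cong n (λ i j _ _ → reflexive (setCol-comm c (suc c) p q A i j (λ ())))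
      reassemble : ∀ p q {X : Matrix} → (∀ i → X i c ≡ p i) → (∀ i → X i (suc c) ≡ q i) →
                   (∀ i j → j ≢ c → j ≢ suc c → X i j ≡ A i j) → f p q ≈ det′ n X
      reassemble p q {X} Xc X1+c Xother = det′-cong n (λ i j _ _ → reflexive (entry i j))
        where
          entry : ∀ i j → setCol c p (inner q) i j ≡ X i j
          entry i j with j ≟ c | j ≟ suc c
          ... | yes ≡.refl | _          = ≡.trans (setCol-same j p (inner q) i) (≡.sym (Xc i))
          ... | no j≢c     | yes ≡.refl = ≡.trans (setCol-other c j p (inner q) i j≢c) (≡.trans (setCol-same (suc c) q A i) (≡.sym (X1+c i)))
          ... | no j≢c     | no j≢1+c   = ≡.trans (setCol-other c j p (inner q) i j≢c) (≡.trans (setCol-other (suc c) j q A i j≢1+c) (≡.sym (Xother i j j≢c j≢1+c)))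

  det′-equalColumns : ∀ n {c h} (A : Matrix) → c < h → h < n → (∀ i → A i c ≈ A i h) → det′ n A ≈ 0#
  det′-equalColumns n {c} {suc h} A (s≤s c≤h) 1+h<n eq with m≤n⇒m<n∨m≡n c≤h
  ... | inj₂ ≡.refl = det′-adjacentEqual n c A 1+h<n eq
  ... | inj₁ c<h    = begin
      det′ n A                                    ≈⟨ sym (-‿involutive _) ⟩
      - (- det′ n A)                              ≈⟨ -‿cong (sym (det′-swapAdjacent n h A 1+h<n)) ⟩
      - det′ n (λ i j → A i (transposeℕ h j))     ≈⟨ -‿cong (det′-equalColumns n _ c<h (<-trans (n<1+n h) 1+h<n) moved) ⟩
      - 0#                                        ≈⟨ -0#≈0# ⟩
      0#                                          ∎
    where
      moved : ∀ i → A i (transposeℕ h c) ≈ A i (transposeℕ h h)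
      moved i = begin
        A i (transposeℕ h c) ≡⟨ ≡.cong (A i) (transposeℕ-other h c (λ e → <-irrefl e c<h) (λ e → <-irrefl e (<-trans c<h (n<1+n h)))) ⟩
        A i c                ≈⟨ eq i ⟩
        A i (suc h)          ≡⟨ ≡.cong (A i) (transposeℕ-self h) ⟨
        A i (transposeℕ h h) ∎

  det′-addColumn : ∀ n c h → c < n → h < n → c ≢ h → (A B : Matrix) (s : Carrier) →
                   (∀ i j → j ≢ c → B i j ≈ A i j) → (∀ i → B i c ≈ A i c + s * A i h) → det′ n B ≈ det′ n A
  det′-addColumn n c h c<n h<n c≢h A B s B≈A B≈A+sA = begin
      det′ n B
    ≈⟨ det′-linear n c c<n B A X s B≈A (λ i j j≢c → trans (B≈A i j j≢c) (reflexive (≡.sym (setCol-other c j column-h A i j≢c))))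
         (λ i → trans (B≈A+sA i) (+-congˡ (*-congˡ (reflexive (≡.sym (setCol-same c column-h A i)))))) ⟩
      det′ n A + s * det′ n X
    ≈⟨ trans (+-congˡ (trans (*-congˡ X-singular) (zeroʳ s))) (+-identityʳ _) ⟩
      det′ n A
    ∎
    where
      column-h : ℕ → Carrier
      column-h i = A i h
      X : Matrix
      X = setCol c column-h A
      X-singular : det′ n X ≈ 0#
      X-singular with <-cmp c h
      ... | tri< c<h _ _ = det′-equalColumns n X c<h h<n (λ i →
              reflexive (≡.trans (setCol-same c column-h A i) (≡.sym (setCol-other c h column-h A i (λ e → c≢h (≡.sym e))))))
      ... | tri≈ _ c≡h _ = contradiction c≡h c≢h
      ... | tri> _ _ h<c = det′-equalColumns n X h<c c<n (λ i →
              reflexive (≡.trans (setCol-other c h column-h A i (λ e → c≢h (≡.sym e))) (≡.sym (setCol-same c column-h A i))))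

  det′-addColumns : ∀ n c m → m ≤ c → c < n → (t : ℕ → Carrier) (A B : Matrix) →
                    (∀ i j → j ≢ c → B i j ≈ A i j) → (∀ i → B i c ≈ A i c + ∑ m (λ h → t h * A i h)) →
                    det′ n B ≈ det′ n A
  det′-addColumns n c zero    _     c<n t A B B≈A B≈A+∑ = det′-cong n entry
    where
      entry : ∀ i j → i < n → j < n → B i j ≈ A i j
      entry i j _ _ with j ≟ c
      ... | yes ≡.refl = trans (B≈A+∑ i) (+-identityʳ _)
      ... | no j≢c     = B≈A i j j≢c
  det′-addColumns n c (suc m) 1+m≤c c<n t A B B≈A B≈A+∑ =
    trans (det′-addColumn n c m c<n (<-trans 1+m≤c c<n) (λ e → <-irrefl (≡.sym e) 1+m≤c) B′ B (t m)
             (λ i j j≢c → trans (B≈A i j j≢c) (reflexive (≡.sym (setCol-other c j partial A i j≢c))))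
             (λ i → begin
                B i c                                              ≈⟨ B≈A+∑ i ⟩
                A i c + ∑ (suc m) (λ h → t h * A i h)              ≈⟨ +-congˡ (∑-snoc m (λ h → t h * A i h)) ⟩
                A i c + (∑ m (λ h → t h * A i h) + t m * A i m)    ≈⟨ sym (+-assoc _ _ _) ⟩
                (A i c + ∑ m (λ h → t h * A i h)) + t m * A i m    ≈⟨ +-cong (reflexive (≡.sym (setCol-same c partial A i)))
                                                                            (*-congˡ (reflexive (≡.sym (setCol-other c m partial A i (λ e → <-irrefl e 1+m≤c))))) ⟩
                B′ i c + t m * B′ i m                              ∎))
          (det′-addColumns n c m (<⇒≤ 1+m≤c) c<n t A B′ (λ i j j≢c → reflexive (setCol-other c j partial A i j≢c))
             (λ i → reflexive (setCol-same c partial A i)))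
    where
      partial : ℕ → Carrier
      partial i = A i c + ∑ m (λ h → t h * A i h)
      B′ : Matrix
      B′ = setCol c partial A

  det′-lowerTriangular : ∀ n (A : Matrix) → (∀ i j → i < j → j < n → A i j ≈ 0#) → det′ n A ≈ ∏ n (λ i → A i i)
  det′-lowerTriangular zero    A upper = refl
  det′-lowerTriangular (suc n) A upper = begin
      det′ (suc n) A
    ≈⟨ det′-expand n A ⟩
      sgn 0 * (A 0 0 * det′ n (minor 0 A)) + ∑ n (λ j → sgn (suc j) * (A 0 (suc j) * det′ n (minor (suc j) A)))
    ≈⟨ +-cong (*-identityˡ _) (∑-zero n (λ j j<n → trans (*-congˡ (trans (*-congʳ (upper 0 (suc j) (s≤s z≤n) (s≤s j<n))) (zeroˡ _))) (zeroʳ _))) ⟩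
      A 0 0 * det′ n (minor 0 A) + 0#
    ≈⟨ +-identityʳ _ ⟩
      A 0 0 * det′ n (minor 0 A)
    ≈⟨ *-congˡ (det′-lowerTriangular n (minor 0 A) (λ i j i<j j<n → upper (suc i) (suc j) (s≤s i<j) (s≤s j<n))) ⟩
      ∏ (suc n) (λ i → A i i)
    ∎

  mixCols : ℕ → Matrix → Matrix → Matrix
  mixCols s N M i j = if j <ᵇ s then N i j else M i j

  mixCols-< : ∀ s j N M i → j < s → mixCols s N M i j ≡ N i j
  mixCols-< s j N M i j<s with j <ᵇ s | <⇒<ᵇ j<s
  ... | true  | _ = ≡.refl
  ... | false | ()

  mixCols-≥ : ∀ s j N M i → s ≤ j → mixCols s N M i j ≡ M i j
  mixCols-≥ s j N M i s≤j with j <ᵇ s | <ᵇ⇒< j s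
  ... | false | _   = ≡.refl
  ... | true  | j<s = contradiction (j<s _) (≤⇒≯ s≤j)

  det′-unitriangularColOps : ∀ n (N M U : Matrix) →
                             (∀ i j → i < n → j < n → M i j ≈ N i j + ∑ j (λ h → U h j * N i h)) →
                             det′ n M ≈ det′ n N
  det′-unitriangularColOps n N M U M≈NU = trans (det′-cong n (λ i j i<n _ → reflexive (≡.sym (padded-< i j i<n))))
                                                (fromColumn n 0 (ℕₚ.+-identityʳ n))
    where
      combined : Matrix
      combined i j = N i j + ∑ j (λ h → U h j * N i h)
      -- rows i ≥ n do not affect det′ n; padding them makes the hypothesis hold in every row
      padded : Matrix
      padded i j = if i <ᵇ n then M i j else combined i j
      padded-< : ∀ i j → i < n → padded i j ≡ M i j
      padded-< i j i<n with i <ᵇ n | <⇒<ᵇ i<n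
      ... | true  | _ = ≡.refl
      ... | false | ()
      padded≈NU : ∀ i j → j < n → padded i j ≈ combined i j
      padded≈NU i j j<n with i <ᵇ n | <ᵇ⇒< i n
      ... | true  | i<n = M≈NU i j (i<n _) j<n
      ... | false | _   = refl
      step : ∀ s → s < n → det′ n (mixCols s N padded) ≈ det′ n (mixCols (suc s) N padded)
      step s s<n = det′-addColumns n s s ≤-refl s<n (λ h → U h s) (mixCols (suc s) N padded) (mixCols s N padded)
        (λ i j j≢s → reflexive (unchanged i j j≢s))
        (λ i → begin
          mixCols s N padded i s                                ≡⟨ mixCols-≥ s s N padded i ≤-refl ⟩
          padded i s                                            ≈⟨ padded≈NU i s s<n ⟩
          N i s + ∑ s (λ h → U h s * N i h)                     ≈⟨ sym (+-cong (reflexive (mixCols-< (suc s) s N padded i (n<1+n s)))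
                                                                     (∑-cong s (λ h h<s → *-congˡ (reflexive (mixCols-< (suc s) h N padded i (<-trans h<s (n<1+n s))))))) ⟩
          mixCols (suc s) N padded i s + ∑ s (λ h → U h s * mixCols (suc s) N padded i h) ∎)
        where
          unchanged : ∀ i j → j ≢ s → mixCols s N padded i j ≡ mixCols (suc s) N padded i j
          unchanged i j j≢s with <-cmp j s
          ... | tri< j<s _ _ = ≡.trans (mixCols-< s j N padded i j<s) (≡.sym (mixCols-< (suc s) j N padded i (<-trans j<s (n<1+n s))))
          ... | tri≈ _ j≡s _ = contradiction j≡s j≢s
          ... | tri> _ _ s<j = ≡.trans (mixCols-≥ s j N padded i (<⇒≤ s<j)) (≡.sym (mixCols-≥ (suc s) j N padded i s<j))
      fromColumn : ∀ d s → d ℕ.+ s ≡ n → det′ n (mixCols s N padded) ≈ det′ n N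
      fromColumn zero    s ≡.refl = det′-cong s (λ i j _ j<s → reflexive (mixCols-< s j N padded i j<s))
      fromColumn (suc d) s d+s≡n  = trans (step s s<n) (fromColumn d (suc s) (≡.trans (ℕₚ.+-suc d s) d+s≡n))
        where
          s<n : s < n
          s<n = ≡.subst (s <_) d+s≡n (s≤s (m≤n+m s d))

module HankelLucas {c ℓ : Level} (R : CommutativeRing c ℓ) where
  open import Data.Nat.Combinatorics using (_C_)
  open CommutativeRing R hiding (zero)
  open import Algebra.Properties.Ring ring using (-‿distribʳ-*)
  open import Algebra.Properties.Group +-group using (∙-cancelˡ; x≈z//y; //-rightDividesˡ)
  open Determinant R
  open import Relation.Binary.Reasoning.Setoid setoid
  -- coefficients of an abstract ring cannot be normalised, so the ℕ-coefficient semiring solver is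
  -- used with negated terms as atoms, and cancellations such as x * x + - (x * x) ≈ 0# are done by hand
  open SemiringSolver commutativeSemiring using (solve; _:=_; _:+_; _:*_; con)

  infixr 8 _^_
  _^_ : Carrier → ℕ → Carrier
  x ^ n = pow R x n

  1^n≈1 : ∀ n → 1# ^ n ≈ 1#
  1^n≈1 zero    = refl
  1^n≈1 (suc n) = trans (*-identityˡ _) (1^n≈1 n)

  fromℕ-+ : ∀ m n → fromℕ R (m ℕ.+ n) ≈ fromℕ R m + fromℕ R n
  fromℕ-+ zero    n = sym (+-identityˡ _)
  fromℕ-+ (suc m) n = trans (+-congˡ (fromℕ-+ m n)) (sym (+-assoc _ _ _))

  fromℕ-≡ : ∀ {m n} → m ≡ n → fromℕ R m ≈ fromℕ R n
  fromℕ-≡ m≡n = reflexive (≡.cong (fromℕ R) m≡n)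

  fromℕ-1 : fromℕ R 1 ≈ 1#
  fromℕ-1 = +-identityʳ 1#

  fromℕ-pred : ∀ {n} → 1 ≤ n → fromℕ R n ≈ 1# + fromℕ R (n ∸ 1)
  fromℕ-pred {suc n} _ = refl

  module _ (s : Carrier) where

    fibonacci : ℕ → Carrier
    fibonacci zero          = 0#
    fibonacci (suc zero)    = 1#
    fibonacci (suc (suc n)) = fibonacci (suc n) + s * fibonacci n

    diagonalTerm : ℕ → ℕ → Carrier
    diagonalTerm N j = fromℕ R (binom (N ∸ j) j) * s ^ j

    diagonalSum : ℕ → Carrier
    diagonalSum N = ∑ (suc N) (diagonalTerm N)

    diagonalTerm-vanishes : ∀ N j → N < j ℕ.+ j → diagonalTerm N j ≈ 0#
    diagonalTerm-vanishes N (suc j) N<2j =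
      trans (*-congʳ (fromℕ-≡ (n<k⇒binom≡0 (ℕₚ.m<n+o⇒m∸n<o N (suc j) N<2j)))) (zeroˡ _)

    diagonalSum-truncated : ∀ N → ∑ (suc ⌊ N /2⌋) (diagonalTerm N) ≈ diagonalSum N
    diagonalSum-truncated N = trans
      (sym (∑-extend (suc ⌊ N /2⌋) (N ∸ ⌊ N /2⌋) (diagonalTerm N)
              (λ j ⌊N/2⌋<j → diagonalTerm-vanishes N j (⌊n/2⌋<j⇒n<j+j N j ⌊N/2⌋<j))))
      (reflexive (≡.cong (λ t → ∑ t (diagonalTerm N)) (≡.cong suc (ℕₚ.m+[n∸m]≡n (ℕₚ.⌊n/2⌋≤n N)))))

    diagonalSum-step : ∀ N → diagonalSum (suc (suc N)) ≈ diagonalSum (suc N) + s * diagonalSum N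
    diagonalSum-step N = begin
        diagonalTerm (suc (suc N)) 0 + ∑ (suc (suc N)) (λ j → diagonalTerm (suc (suc N)) (suc j))
      ≈⟨ +-congˡ (∑-cong (suc (suc N)) (λ j _ → pascal j)) ⟩
        diagonalTerm (suc (suc N)) 0 + ∑ (suc (suc N)) (λ j → upper j + s * diagonalTerm N j)
      ≈⟨ +-congˡ (∑-+ (suc (suc N)) upper (λ j → s * diagonalTerm N j)) ⟩
        diagonalTerm (suc (suc N)) 0 + (∑ (suc (suc N)) upper + ∑ (suc (suc N)) (λ j → s * diagonalTerm N j))
      ≈⟨ +-congˡ (+-cong (∑-snoc (suc N) upper) (trans (∑-*ˡ (suc (suc N)) s (diagonalTerm N)) (*-congˡ (∑-snoc (suc N) (diagonalTerm N))))) ⟩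
        diagonalTerm (suc (suc N)) 0 + ((∑ (suc N) upper + upper (suc N)) + s * (diagonalSum N + diagonalTerm N (suc N)))
      ≈⟨ +-congˡ (+-cong (trans (+-congˡ (diagonalTerm-vanishes (suc N) (suc (suc N)) (beyond (suc N)))) (+-identityʳ _))
                         (*-congˡ (trans (+-congˡ (diagonalTerm-vanishes N (suc N) (beyond N))) (+-identityʳ _)))) ⟩
        diagonalTerm (suc (suc N)) 0 + (∑ (suc N) upper + s * diagonalSum N)
      ≈⟨ sym (+-assoc _ _ _) ⟩
        diagonalSum (suc N) + s * diagonalSum N
      ∎
      where
        upper : ℕ → Carrier
        upper = λ j → diagonalTerm (suc N) (suc j)
        beyond : ∀ n → n < suc n ℕ.+ suc n
        beyond n = ℕₚ.m≤n⇒m≤n+o (suc n) ℕₚ.≤-refl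
        pascal : ∀ j → diagonalTerm (suc (suc N)) (suc j) ≈ upper j + s * diagonalTerm N j
        pascal j = begin
            fromℕ R (binom (suc N ∸ j) (suc j)) * (s * s ^ j)
          ≈⟨ *-congʳ (trans (fromℕ-≡ (binom-diagonal N j)) (fromℕ-+ (binom (N ∸ j) (suc j)) (binom (N ∸ j) j))) ⟩
            (fromℕ R (binom (N ∸ j) (suc j)) + fromℕ R (binom (N ∸ j) j)) * (s * s ^ j)
          ≈⟨ solve 4 (λ a b s p → ((a :+ b) :* (s :* p)) := (a :* (s :* p) :+ s :* (b :* p))) refl _ _ _ _ ⟩
            upper j + s * diagonalTerm N j
          ∎

    diagonalSum≈fibonacci : ∀ N → diagonalSum N ≈ fibonacci (suc N)
    diagonalSum≈fibonacci zero          = trans (+-identityʳ _) (trans (*-identityʳ _) fromℕ-1)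
    diagonalSum≈fibonacci (suc zero)    = begin
        fromℕ R 1 * 1# + (fromℕ R 0 * (s * 1#) + 0#)  ≈⟨ +-cong (trans (*-identityʳ _) fromℕ-1) (trans (+-identityʳ _) (zeroˡ _)) ⟩
        1# + 0#                                        ≈⟨ +-congˡ (sym (zeroʳ s)) ⟩
        1# + s * 0#                                    ∎
    diagonalSum≈fibonacci (suc (suc N)) =
      trans (diagonalSum-step N) (+-cong (diagonalSum≈fibonacci (suc N)) (*-congˡ (diagonalSum≈fibonacci N)))

    -- by lucas-coeff each Lucas coefficient splits into two shallow-diagonal binomials
    lucas≈fibonacci : ∀ m → Lucas R (suc m) 1# s ≈ fibonacci (suc (suc m)) + s * fibonacci m
    lucas≈fibonacci m = begin
        Lucas R (suc m) 1# s
      ≈⟨ reflexive (sumFin≡∑ H (λ j → fromℕ R ((suc m ℕ.* ((suc m ∸ j) C j)) ÷ (suc m ∸ j)) * (s ^ j * 1# ^ (suc m ∸ (j ℕ.+ j))))) ⟩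
        ∑ H (λ j → fromℕ R ((suc m ℕ.* ((suc m ∸ j) C j)) ÷ (suc m ∸ j)) * (s ^ j * 1# ^ (suc m ∸ (j ℕ.+ j))))
      ≈⟨ ∑-cong H split ⟩
        ∑ H (λ j → diagonalTerm (suc m) j + fromℕ R (lucasTail m j) * s ^ j)
      ≈⟨ ∑-+ H (diagonalTerm (suc m)) (λ j → fromℕ R (lucasTail m j) * s ^ j) ⟩
        ∑ H (diagonalTerm (suc m)) + ∑ H (λ j → fromℕ R (lucasTail m j) * s ^ j)
      ≈⟨ +-cong (trans (diagonalSum-truncated (suc m)) (diagonalSum≈fibonacci (suc m))) (tail m) ⟩
        fibonacci (suc (suc m)) + s * fibonacci m
      ∎
      where
        H = suc ⌊ suc m /2⌋
        split : ∀ j → j < H → fromℕ R ((suc m ℕ.* ((suc m ∸ j) C j)) ÷ (suc m ∸ j)) * (s ^ j * 1# ^ (suc m ∸ (j ℕ.+ j)))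
                            ≈ diagonalTerm (suc m) j + fromℕ R (lucasTail m j) * s ^ j
        split j (s≤s j≤H) = begin
            fromℕ R ((suc m ℕ.* ((suc m ∸ j) C j)) ÷ (suc m ∸ j)) * (s ^ j * 1# ^ (suc m ∸ (j ℕ.+ j)))
          ≈⟨ *-cong (trans (fromℕ-≡ (lucas-coeff m j (ℕₚ.≤-trans j≤H (ℕₚ.≤-pred (ℕₚ.⌊n/2⌋<n m))))) (fromℕ-+ (binom (suc m ∸ j) j) (lucasTail m j)))
                    (trans (*-congˡ (1^n≈1 (suc m ∸ (j ℕ.+ j)))) (*-identityʳ _)) ⟩
            (fromℕ R (binom (suc m ∸ j) j) + fromℕ R (lucasTail m j)) * s ^ j
          ≈⟨ distribʳ _ _ _ ⟩
            diagonalTerm (suc m) j + fromℕ R (lucasTail m j) * s ^ j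
          ∎
        tail : ∀ m → ∑ (suc ⌊ suc m /2⌋) (λ j → fromℕ R (lucasTail m j) * s ^ j) ≈ s * fibonacci m
        tail zero     = trans (+-identityʳ _) (trans (zeroˡ _) (sym (zeroʳ s)))
        tail (suc m′) = begin
            fromℕ R 0 * s ^ 0 + ∑ (suc ⌊ m′ /2⌋) (λ j → fromℕ R (binom (m′ ∸ j) j) * (s * s ^ j))
          ≈⟨ +-cong (zeroˡ _) (∑-cong (suc ⌊ m′ /2⌋) (λ j _ → solve 3 (λ a s p → (a :* (s :* p)) := (s :* (a :* p))) refl (fromℕ R (binom (m′ ∸ j) j)) s (s ^ j))) ⟩
            0# + ∑ (suc ⌊ m′ /2⌋) (λ j → s * diagonalTerm m′ j)
          ≈⟨ trans (+-identityˡ _) (∑-*ˡ (suc ⌊ m′ /2⌋) s (diagonalTerm m′)) ⟩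
            s * ∑ (suc ⌊ m′ /2⌋) (diagonalTerm m′)
          ≈⟨ *-congˡ (trans (diagonalSum-truncated m′) (diagonalSum≈fibonacci m′)) ⟩
            s * fibonacci (suc m′)
          ∎

  adjacency : (ℕ → Carrier) → ℕ → Carrier
  adjacency w zero    = w 0 + w 1
  adjacency w (suc h) = w h + w (suc (suc h))

  -- J is symmetric; truncating the pairing to the indices ≤ b leaves one boundary term on each side
  adjacency-symmetric : ∀ (a w : ℕ → Carrier) b →
    ∑ (suc b) (λ h → a h * adjacency w h) + a (suc b) * w b ≈ ∑ (suc b) (λ h → adjacency a h * w h) + a b * w (suc b)
  adjacency-symmetric a w zero = solve 4 (λ a₀ a₁ w₀ w₁ →
      ((a₀ :* (w₀ :+ w₁) :+ con 0) :+ a₁ :* w₀) := (((a₀ :+ a₁) :* w₀ :+ con 0) :+ a₀ :* w₁)) refl (a 0) (a 1) (w 0) (w 1)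
  adjacency-symmetric a w (suc b) = begin
      ∑ (suc (suc b)) (λ h → a h * adjacency w h) + a (suc (suc b)) * w (suc b)
    ≈⟨ +-congʳ (∑-snoc (suc b) (λ h → a h * adjacency w h)) ⟩
      (S + a (suc b) * (w b + w (suc (suc b)))) + a (suc (suc b)) * w (suc b)
    ≈⟨ solve 6 (λ S a₁ a₂ w₀ w₁ w₂ → ((S :+ a₁ :* (w₀ :+ w₂)) :+ a₂ :* w₁) := ((S :+ a₁ :* w₀) :+ (a₁ :* w₂ :+ a₂ :* w₁))) refl
         S (a (suc b)) (a (suc (suc b))) (w b) (w (suc b)) (w (suc (suc b))) ⟩
      (S + a (suc b) * w b) + (a (suc b) * w (suc (suc b)) + a (suc (suc b)) * w (suc b))
    ≈⟨ +-congʳ (adjacency-symmetric a w b) ⟩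
      (T + a b * w (suc b)) + (a (suc b) * w (suc (suc b)) + a (suc (suc b)) * w (suc b))
    ≈⟨ solve 6 (λ T a₀ a₁ a₂ w₁ w₂ → ((T :+ a₀ :* w₁) :+ (a₁ :* w₂ :+ a₂ :* w₁)) := ((T :+ (a₀ :+ a₂) :* w₁) :+ a₁ :* w₂)) refl
         T (a b) (a (suc b)) (a (suc (suc b))) (w (suc b)) (w (suc (suc b))) ⟩
      (T + (a b + a (suc (suc b))) * w (suc b)) + a (suc b) * w (suc (suc b))
    ≈⟨ +-congʳ (sym (∑-snoc (suc b) (λ h → adjacency a h * w h))) ⟩
      ∑ (suc (suc b)) (λ h → adjacency a h * w h) + a (suc b) * w (suc (suc b))
    ∎
    where
      S = ∑ (suc b) (λ h → a h * adjacency w h)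
      T = ∑ (suc b) (λ h → adjacency a h * w h)

  pathsᴿ : ℕ → ℕ → Carrier
  pathsᴿ i h = fromℕ R (paths i h)

  pathsᴿ-step : ∀ i h → pathsᴿ (suc i) h ≈ adjacency (pathsᴿ i) h
  pathsᴿ-step i zero    = fromℕ-+ (paths i 0) (paths i 1)
  pathsᴿ-step i (suc h) = fromℕ-+ (paths i h) (paths i (suc (suc h)))

  pathsᴿ-vanishes : ∀ {i h} → i < h → pathsᴿ i h ≈ 0#
  pathsᴿ-vanishes i<h = fromℕ-≡ (i<h⇒paths≡0 i<h)

  pathsᴿ-diag : ∀ i → pathsᴿ i i ≈ 1#
  pathsᴿ-diag i = trans (fromℕ-≡ (paths-diag i)) fromℕ-1

  -- ⟨Jⁱe₀, Jʲe₀⟩ = ⟨Jⁱ⁺ʲe₀, e₀⟩, computed on the coordinates ≤ b, which carry Jⁱe₀ as long as i ≤ b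
  gram-upTo : ∀ b i j → i ≤ b → ∑ (suc b) (λ h → pathsᴿ i h * pathsᴿ j h) ≈ pathsᴿ (i ℕ.+ j) 0
  gram-upTo b zero    j _   = begin
      pathsᴿ 0 0 * pathsᴿ j 0 + ∑ b (λ h → pathsᴿ 0 (suc h) * pathsᴿ j (suc h))
    ≈⟨ +-cong (trans (*-congʳ fromℕ-1) (*-identityˡ _)) (∑-zero b (λ h _ → zeroˡ _)) ⟩
      pathsᴿ j 0 + 0#
    ≈⟨ +-identityʳ _ ⟩
      pathsᴿ j 0
    ∎
  gram-upTo b (suc i) j i<b = begin
      ∑ (suc b) (λ h → pathsᴿ (suc i) h * pathsᴿ j h)
    ≈⟨ ∑-cong (suc b) {λ h → pathsᴿ (suc i) h * pathsᴿ j h} (λ h _ → *-congʳ (pathsᴿ-step i h)) ⟩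
      ∑ (suc b) (λ h → adjacency (pathsᴿ i) h * pathsᴿ j h)
    ≈⟨ sym (trans (+-congˡ (trans (*-congʳ (pathsᴿ-vanishes i<b)) (zeroˡ _))) (+-identityʳ _)) ⟩
      ∑ (suc b) (λ h → adjacency (pathsᴿ i) h * pathsᴿ j h) + pathsᴿ i b * pathsᴿ j (suc b)
    ≈⟨ sym (adjacency-symmetric (pathsᴿ i) (pathsᴿ j) b) ⟩
      ∑ (suc b) (λ h → pathsᴿ i h * adjacency (pathsᴿ j) h) + pathsᴿ i (suc b) * pathsᴿ j b
    ≈⟨ trans (+-congˡ (trans (*-congʳ (pathsᴿ-vanishes (ℕₚ.m<n⇒m<1+n i<b))) (zeroˡ _))) (+-identityʳ _) ⟩
      ∑ (suc b) (λ h → pathsᴿ i h * adjacency (pathsᴿ j) h)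
    ≈⟨ ∑-cong (suc b) {g = λ h → pathsᴿ i h * pathsᴿ (suc j) h} (λ h _ → *-congˡ (sym (pathsᴿ-step j h))) ⟩
      ∑ (suc b) (λ h → pathsᴿ i h * pathsᴿ (suc j) h)
    ≈⟨ gram-upTo b i (suc j) (ℕₚ.<⇒≤ i<b) ⟩
      pathsᴿ (i ℕ.+ suc j) 0
    ≈⟨ reflexive (≡.cong (λ t → pathsᴿ t 0) (ℕₚ.+-suc i j)) ⟩
      pathsᴿ (suc i ℕ.+ j) 0
    ∎

  gram : ∀ i j → ∑ (suc j) (λ h → pathsᴿ j h * pathsᴿ i h) ≈ pathsᴿ (i ℕ.+ j) 0
  gram i j = begin
      ∑ (suc j) (λ h → pathsᴿ j h * pathsᴿ i h)
    ≈⟨ sym (∑-extend (suc j) i (λ h → pathsᴿ j h * pathsᴿ i h) (λ h j<h → trans (*-congʳ (pathsᴿ-vanishes j<h)) (zeroˡ _))) ⟩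
      ∑ (suc j ℕ.+ i) (λ h → pathsᴿ j h * pathsᴿ i h)
    ≈⟨ ∑-cong (suc j ℕ.+ i) {λ h → pathsᴿ j h * pathsᴿ i h} (λ h _ → *-comm _ _) ⟩
      ∑ (suc (j ℕ.+ i)) (λ h → pathsᴿ i h * pathsᴿ j h)
    ≈⟨ reflexive (≡.cong (λ b → ∑ (suc b) (λ h → pathsᴿ i h * pathsᴿ j h)) (ℕₚ.+-comm j i)) ⟩
      ∑ (suc (i ℕ.+ j)) (λ h → pathsᴿ i h * pathsᴿ j h)
    ≈⟨ gram-upTo (i ℕ.+ j) i j (ℕₚ.m≤m+n i j) ⟩
      pathsᴿ (i ℕ.+ j) 0
    ∎

  module _ (x : Carrier) where

    ρ : ℕ → Carrier
    ρ zero          = 1#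
    ρ (suc zero)    = 1# - x
    ρ (suc (suc h)) = ρ (suc h) + - (x * x) * ρ h

    -- dual K pairs with the path vector Jⁱe₀ to x^(K − i)
    dual : ℕ → ℕ → Carrier
    dual K h = x ^ (K ∸ h) * ρ h

    adjacency-dual : ∀ K h → h < suc K → adjacency (dual (suc K)) h ≈ dual K h
    adjacency-dual K zero    _ = begin
        (x * x ^ K) * 1# + x ^ K * (1# - x)
      ≈⟨ solve 3 (λ x p y → ((x :* p) :* con 1 :+ p :* (con 1 :+ y)) := (p :* con 1 :+ p :* (x :+ y))) refl x (x ^ K) (- x) ⟩
        x ^ K * 1# + x ^ K * (x - x)
      ≈⟨ trans (+-congˡ (trans (*-congˡ (-‿inverseʳ x)) (zeroʳ _))) (+-identityʳ _) ⟩
        x ^ K * 1#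
      ∎
    adjacency-dual K (suc h) (s≤s h<K) = begin
        x ^ (suc K ∸ h) * ρ h + x ^ (K ∸ suc h) * (ρ (suc h) + - (x * x) * ρ h)
      ≈⟨ +-congʳ (*-congʳ (reflexive (≡.cong (x ^_) (exponent K h h<K)))) ⟩
        (x * (x * q)) * ρ h + q * (ρ (suc h) + - (x * x) * ρ h)
      ≈⟨ solve 5 (λ x q a b s → ((x :* (x :* q)) :* a :+ q :* (b :+ s :* a)) := (q :* b :+ (x :* x :+ s) :* (q :* a)))
           refl x q (ρ h) (ρ (suc h)) (- (x * x)) ⟩
        q * ρ (suc h) + (x * x + - (x * x)) * (q * ρ h)
      ≈⟨ trans (+-congˡ (trans (*-congʳ (-‿inverseʳ (x * x))) (zeroˡ _))) (+-identityʳ _) ⟩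
        q * ρ (suc h)
      ∎
      where
        q = x ^ (K ∸ suc h)
        exponent : ∀ K h → h < K → suc K ∸ h ≡ suc (suc (K ∸ suc h))
        exponent (suc K) zero    _         = ≡.refl
        exponent (suc K) (suc h) (s≤s h<K) = exponent K h h<K

    dual-pairing : ∀ K i → i ≤ K → ∑ (suc K) (λ h → dual K h * pathsᴿ i h) ≈ x ^ (K ∸ i)
    dual-pairing K       zero    _         = begin
        dual K 0 * pathsᴿ 0 0 + ∑ K (λ h → dual K (suc h) * 0#)
      ≈⟨ +-cong (trans (*-congˡ fromℕ-1) (trans (*-identityʳ _) (*-identityʳ _))) (∑-zero K (λ h _ → zeroʳ _)) ⟩
        x ^ K + 0#
      ≈⟨ +-identityʳ _ ⟩
        x ^ K
      ∎
    dual-pairing (suc K) (suc i) (s≤s i≤K) = begin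
        ∑ (suc (suc K)) (λ h → dual (suc K) h * pathsᴿ (suc i) h)
      ≈⟨ ∑-cong (suc (suc K)) {g = λ h → dual (suc K) h * adjacency (pathsᴿ i) h} (λ h _ → *-congˡ (pathsᴿ-step i h)) ⟩
        ∑ (suc (suc K)) (λ h → dual (suc K) h * adjacency (pathsᴿ i) h)
      ≈⟨ sym (trans (+-congˡ (trans (*-congˡ (pathsᴿ-vanishes i<2+K)) (zeroʳ _))) (+-identityʳ _)) ⟩
        ∑ (suc (suc K)) (λ h → dual (suc K) h * adjacency (pathsᴿ i) h) + dual (suc K) (suc (suc K)) * pathsᴿ i (suc K)
      ≈⟨ adjacency-symmetric (dual (suc K)) (pathsᴿ i) (suc K) ⟩
        ∑ (suc (suc K)) (λ h → adjacency (dual (suc K)) h * pathsᴿ i h) + dual (suc K) (suc K) * pathsᴿ i (suc (suc K))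
      ≈⟨ trans (+-congˡ (trans (*-congˡ (pathsᴿ-vanishes (ℕₚ.m<n⇒m<1+n i<2+K))) (zeroʳ _))) (+-identityʳ _) ⟩
        ∑ (suc (suc K)) (λ h → adjacency (dual (suc K)) h * pathsᴿ i h)
      ≈⟨ ∑-snoc (suc K) (λ h → adjacency (dual (suc K)) h * pathsᴿ i h) ⟩
        ∑ (suc K) (λ h → adjacency (dual (suc K)) h * pathsᴿ i h) + adjacency (dual (suc K)) (suc K) * pathsᴿ i (suc K)
      ≈⟨ trans (+-congˡ (trans (*-congˡ (pathsᴿ-vanishes i<2+K)) (zeroʳ _))) (+-identityʳ _) ⟩
        ∑ (suc K) (λ h → adjacency (dual (suc K)) h * pathsᴿ i h)
      ≈⟨ ∑-cong (suc K) {g = λ h → dual K h * pathsᴿ i h} (λ h h<K → *-congʳ (adjacency-dual K h h<K)) ⟩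
        ∑ (suc K) (λ h → dual K h * pathsᴿ i h)
      ≈⟨ dual-pairing K i i≤K ⟩
        x ^ (K ∸ i)
      ∎
      where
        i<2+K : i < suc K
        i<2+K = s≤s i≤K

    ρ≈fibonacci : ∀ n → ρ n ≈ fibonacci (- (x * x)) (suc n) + - x * fibonacci (- (x * x)) n
    ρ≈fibonacci zero          = sym (trans (+-congˡ (zeroʳ _)) (+-identityʳ _))
    ρ≈fibonacci (suc zero)    = solve 2 (λ s y → (con 1 :+ y) := ((con 1 :+ s :* con 0) :+ y :* con 1)) refl (- (x * x)) (- x)
    ρ≈fibonacci (suc (suc n)) = begin
        ρ (suc n) + - (x * x) * ρ n
      ≈⟨ +-cong (ρ≈fibonacci (suc n)) (*-congˡ (ρ≈fibonacci n)) ⟩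
        (F (suc (suc n)) + - x * F (suc n)) + - (x * x) * (F (suc n) + - x * F n)
      ≈⟨ solve 5 (λ F₀ F₁ F₂ s y → ((F₂ :+ y :* F₁) :+ s :* (F₁ :+ y :* F₀)) := ((F₂ :+ s :* F₁) :+ y :* (F₁ :+ s :* F₀)))
           refl (F n) (F (suc n)) (F (suc (suc n))) (- (x * x)) (- x) ⟩
        F (suc (suc (suc n))) + - x * F (suc (suc n))
      ∎
      where F = fibonacci (- (x * x))

    module _ (k : ℕ) where

      trimmedᴿ : ℕ → ℕ → Carrier
      trimmedᴿ i h = fromℕ R (trimmedPaths k i h)

      hankelEntry-untrimmed : ∀ i j → (∀ h → h ≤ j → trimmedPaths k i h ≡ paths i h) → i ℕ.+ j ≢ suc (k ℕ.+ k) →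
                              fromℕ R (aSeq k (i ℕ.+ j)) ≈ ∑ (suc j) (λ h → pathsᴿ j h * trimmedᴿ i h)
      hankelEntry-untrimmed i j trimmed≡paths ≢2k+1 = begin
          fromℕ R (aSeq k (i ℕ.+ j))                     ≈⟨ fromℕ-≡ (≡.trans (aSeq-other k _ ≢2k+1) (≡.sym (paths-0 (i ℕ.+ j)))) ⟩
          pathsᴿ (i ℕ.+ j) 0                             ≈⟨ sym (gram i j) ⟩
          ∑ (suc j) (λ h → pathsᴿ j h * pathsᴿ i h)      ≈⟨ ∑-cong (suc j) {g = λ h → pathsᴿ j h * trimmedᴿ i h}
                                                              (λ h h<1+j → *-congˡ (fromℕ-≡ (≡.sym (trimmed≡paths h (ℕₚ.≤-pred h<1+j))))) ⟩
          ∑ (suc j) (λ h → pathsᴿ j h * trimmedᴿ i h)    ∎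

      hankelEntry-corner : fromℕ R (aSeq k (suc (k ℕ.+ k))) ≈ ∑ (suc k) (λ h → pathsᴿ k h * trimmedᴿ (suc k) h)
      hankelEntry-corner = begin
          fromℕ R (aSeq k (suc (k ℕ.+ k)))
        ≈⟨ fromℕ-≡ aSeq≡P∸1 ⟩
          fromℕ R (P ∸ 1)
        ≈⟨ ∙-cancelˡ 1# _ _ (trans (sym (fromℕ-pred (1≤paths-0 (suc (k ℕ.+ k))))) (trans P≈S+1 (+-comm S 1#))) ⟩
          S
        ≈⟨ ∑-cong k (λ h h<k → *-congˡ (fromℕ-≡ (≡.sym (trimmedPaths-column k (suc k) h (λ h≡k → ℕₚ.<-irrefl h≡k h<k))))) ⟩
          ∑ k (λ h → pathsᴿ k h * trimmedᴿ (suc k) h)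
        ≈⟨ sym (trans (+-congˡ (trans (*-congˡ (fromℕ-≡ (trimmedPaths-corner k))) (zeroʳ _))) (+-identityʳ _)) ⟩
          ∑ k (λ h → pathsᴿ k h * trimmedᴿ (suc k) h) + pathsᴿ k k * trimmedᴿ (suc k) k
        ≈⟨ sym (∑-snoc k (λ h → pathsᴿ k h * trimmedᴿ (suc k) h)) ⟩
          ∑ (suc k) (λ h → pathsᴿ k h * trimmedᴿ (suc k) h)
        ∎
        where
          P = paths (suc (k ℕ.+ k)) 0
          S = ∑ k (λ h → pathsᴿ k h * pathsᴿ (suc k) h)
          aSeq≡P∸1 : aSeq k (suc (k ℕ.+ k)) ≡ P ∸ 1
          aSeq≡P∸1 = ≡.trans (aSeq-last k) (≡.cong (_∸ 1) (≡.sym (≡.trans (paths-0 (suc (k ℕ.+ k)))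
                       (≡.cong (suc (k ℕ.+ k) C_) (⌊1+m+m/2⌋≡m k)))))
          P≈S+1 : fromℕ R P ≈ S + 1#
          P≈S+1 = begin
              fromℕ R P                                          ≈⟨ sym (gram (suc k) k) ⟩
              ∑ (suc k) (λ h → pathsᴿ k h * pathsᴿ (suc k) h)    ≈⟨ ∑-snoc k (λ h → pathsᴿ k h * pathsᴿ (suc k) h) ⟩
              S + pathsᴿ k k * pathsᴿ (suc k) k                  ≈⟨ +-congˡ (trans (*-cong (pathsᴿ-diag k) (trans (fromℕ-≡ (paths-subdiag k)) fromℕ-1)) (*-identityˡ 1#)) ⟩
              S + 1#                                             ∎

      -- the Hankel matrix factors as (trimmed paths) · (paths)ᵀ
      hankelEntry : ∀ i j → i ≤ suc k → j ≤ k →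
                    fromℕ R (aSeq k (i ℕ.+ j)) ≈ ∑ (suc j) (λ h → pathsᴿ j h * trimmedᴿ i h)
      hankelEntry i j i≤K j≤k = byCase (i ≟ suc k) (j ≟ k)
        where
          byCase : Dec (i ≡ suc k) → Dec (j ≡ k) → fromℕ R (aSeq k (i ℕ.+ j)) ≈ ∑ (suc j) (λ h → pathsᴿ j h * trimmedᴿ i h)
          byCase (yes ≡.refl) (yes ≡.refl) = hankelEntry-corner
          byCase (yes ≡.refl) (no j≢k)     = hankelEntry-untrimmed i j
            (λ h h≤j → trimmedPaths-column k i h (λ h≡k → j≢k (ℕₚ.≤-antisym j≤k (≡.subst (_≤ j) h≡k h≤j))))
            (λ e → j≢k (ℕₚ.+-cancelˡ-≡ k j k (ℕₚ.suc-injective e)))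
          byCase (no i≢K)     _            = hankelEntry-untrimmed i j (λ h _ → trimmedPaths-row k i h i≢K)
            (λ e → ℕₚ.<-irrefl e (s≤s (ℕₚ.+-mono-≤ (ℕₚ.≤-pred (ℕₚ.≤∧≢⇒< i≤K i≢K)) j≤k)))

      powers : ℕ → Carrier
      powers i = x ^ (suc k ∸ i)

      hankelᴹ : Matrix
      hankelᴹ = mixCols (suc k) (λ i j → fromℕ R (aSeq k (i ℕ.+ j))) (λ i _ → powers i)

      trimmedWith : (ℕ → Carrier) → Matrix
      trimmedWith u = mixCols (suc k) trimmedᴿ (λ i _ → u i)

      trimmedWith-< : ∀ u i j → j < suc k → trimmedWith u i j ≡ trimmedᴿ i j
      trimmedWith-< u i j = mixCols-< (suc k) j trimmedᴿ (λ i _ → u i) i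

      trimmedWith-last : ∀ u i → trimmedWith u i (suc k) ≡ u i
      trimmedWith-last u i = mixCols-≥ (suc k) (suc k) trimmedᴿ (λ i _ → u i) i ℕₚ.≤-refl

      residual : ℕ → Carrier
      residual i = x ^ (suc k ∸ i) - ∑ (suc k) (λ h → dual (suc k) h * trimmedᴿ i h)

      residual-vanishes : ∀ i → i < suc k → residual i ≈ 0#
      residual-vanishes i i<K = trans (+-congˡ (-‿cong pairing)) (-‿inverseʳ _)
        where
          pairing : ∑ (suc k) (λ h → dual (suc k) h * trimmedᴿ i h) ≈ x ^ (suc k ∸ i)
          pairing = begin
              ∑ (suc k) (λ h → dual (suc k) h * trimmedᴿ i h)
            ≈⟨ ∑-cong (suc k) {g = λ h → dual (suc k) h * pathsᴿ i h}
                 (λ h _ → *-congˡ (fromℕ-≡ (trimmedPaths-row k i h (λ i≡K → ℕₚ.<-irrefl i≡K i<K)))) ⟩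
              ∑ (suc k) (λ h → dual (suc k) h * pathsᴿ i h)
            ≈⟨ sym (trans (∑-snoc (suc k) (λ h → dual (suc k) h * pathsᴿ i h))
                          (trans (+-congˡ (trans (*-congˡ (pathsᴿ-vanishes i<K)) (zeroʳ _))) (+-identityʳ _))) ⟩
              ∑ (suc (suc k)) (λ h → dual (suc k) h * pathsᴿ i h)
            ≈⟨ dual-pairing (suc k) i (ℕₚ.<⇒≤ i<K) ⟩
              x ^ (suc k ∸ i)
            ∎

      residual-last : residual (suc k) ≈ ρ (suc k) + x * ρ k
      residual-last = sym (x≈z//y _ _ _ (begin
          (ρ (suc k) + x * ρ k) + T
        ≈⟨ solve 3 (λ a b t → ((a :+ b) :+ t) := ((t :+ b) :+ a)) refl (ρ (suc k)) (x * ρ k) T ⟩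
          (T + x * ρ k) + ρ (suc k)
        ≈⟨ +-cong (+-cong T≈ (sym fk≈)) (sym fK≈) ⟩
          (∑ k f + f k) + f (suc k)
        ≈⟨ sym (trans (∑-snoc (suc k) f) (+-congʳ (∑-snoc k f))) ⟩
          ∑ (suc (suc k)) f
        ≈⟨ dual-pairing (suc k) (suc k) ℕₚ.≤-refl ⟩
          x ^ (suc k ∸ suc k)
        ∎))
        where
          T = ∑ (suc k) (λ h → dual (suc k) h * trimmedᴿ (suc k) h)
          f : ℕ → Carrier
          f h = dual (suc k) h * pathsᴿ (suc k) h
          T≈ : T ≈ ∑ k f
          T≈ = begin
              T
            ≈⟨ ∑-snoc k (λ h → dual (suc k) h * trimmedᴿ (suc k) h) ⟩
              ∑ k (λ h → dual (suc k) h * trimmedᴿ (suc k) h) + dual (suc k) k * trimmedᴿ (suc k) k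
            ≈⟨ trans (+-congˡ (trans (*-congˡ (fromℕ-≡ (trimmedPaths-corner k))) (zeroʳ _))) (+-identityʳ _) ⟩
              ∑ k (λ h → dual (suc k) h * trimmedᴿ (suc k) h)
            ≈⟨ ∑-cong k {g = f} (λ h h<k → *-congˡ (fromℕ-≡ (trimmedPaths-column k (suc k) h (λ h≡k → ℕₚ.<-irrefl h≡k h<k)))) ⟩
              ∑ k f
            ∎
          fk≈ : f k ≈ x * ρ k
          fk≈ = begin
              x ^ (suc k ∸ k) * ρ k * pathsᴿ (suc k) k
            ≈⟨ *-cong (*-congʳ (reflexive (≡.cong (x ^_) (ℕₚ.m+n∸n≡m 1 k)))) (trans (fromℕ-≡ (paths-subdiag k)) fromℕ-1) ⟩
              x * 1# * ρ k * 1#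
            ≈⟨ trans (*-identityʳ _) (*-congʳ (*-identityʳ x)) ⟩
              x * ρ k
            ∎
          fK≈ : f (suc k) ≈ ρ (suc k)
          fK≈ = begin
              x ^ (suc k ∸ suc k) * ρ (suc k) * pathsᴿ (suc k) (suc k)
            ≈⟨ *-cong (*-congʳ (reflexive (≡.cong (x ^_) (ℕₚ.n∸n≡0 k)))) (pathsᴿ-diag (suc k)) ⟩
              1# * ρ (suc k) * 1#
            ≈⟨ trans (*-identityʳ _) (*-identityˡ _) ⟩
              ρ (suc k)
            ∎

      lucas≈ρ : Lucas R (suc k) 1# (- (x * x)) ≈ ρ (suc k) + x * ρ k
      lucas≈ρ = sym (begin
          ρ (suc k) + x * ρ k
        ≈⟨ +-cong (ρ≈fibonacci (suc k)) (*-congˡ (ρ≈fibonacci k)) ⟩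
          (F (suc (suc k)) + - x * F (suc k)) + x * (F (suc k) + - x * F k)
        ≈⟨ solve 5 (λ F₀ F₁ F₂ x y → ((F₂ :+ y :* F₁) :+ x :* (F₁ :+ y :* F₀)) := (F₂ :+ ((x :* y) :* F₀ :+ (y :+ x) :* F₁)))
             refl (F k) (F (suc k)) (F (suc (suc k))) x (- x) ⟩
          F (suc (suc k)) + ((x * - x) * F k + (- x + x) * F (suc k))
        ≈⟨ +-congˡ (+-cong (*-congʳ (sym (-‿distribʳ-* x x))) (trans (*-congʳ (-‿inverseˡ x)) (zeroˡ _))) ⟩
          F (suc (suc k)) + (s * F k + 0#)
        ≈⟨ trans (+-congˡ (+-identityʳ _)) (sym (lucas≈fibonacci s k)) ⟩
          Lucas R (suc k) 1# s
        ∎)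
        where
          s = - (x * x)
          F = fibonacci s

      det-hankel≈trimmedWith-powers : det′ (suc (suc k)) hankelᴹ ≈ det′ (suc (suc k)) (trimmedWith powers)
      det-hankel≈trimmedWith-powers = det′-unitriangularColOps (suc (suc k)) N hankelᴹ U columns
        where
          N = trimmedWith powers
          pathsᵀ : Matrix
          pathsᵀ h j = pathsᴿ j h
          U : Matrix
          U = mixCols (suc k) pathsᵀ (λ _ _ → 0#)
          columns : ∀ i j → i < suc (suc k) → j < suc (suc k) → hankelᴹ i j ≈ N i j + ∑ j (λ h → U h j * N i h)
          columns i j (s≤s i≤K) j<n with ℕₚ.m<1+n⇒m<n∨m≡n j<n
          ... | inj₁ j<K = begin
              hankelᴹ i j
            ≡⟨ mixCols-< (suc k) j (λ i j → fromℕ R (aSeq k (i ℕ.+ j))) (λ i _ → powers i) i j<K ⟩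
              fromℕ R (aSeq k (i ℕ.+ j))
            ≈⟨ hankelEntry i j i≤K (ℕₚ.≤-pred j<K) ⟩
              ∑ (suc j) (λ h → pathsᴿ j h * trimmedᴿ i h)
            ≈⟨ ∑-snoc j (λ h → pathsᴿ j h * trimmedᴿ i h) ⟩
              ∑ j (λ h → pathsᴿ j h * trimmedᴿ i h) + pathsᴿ j j * trimmedᴿ i j
            ≈⟨ trans (+-comm _ _) (+-congʳ (trans (*-congʳ (pathsᴿ-diag j)) (*-identityˡ _))) ⟩
              trimmedᴿ i j + ∑ j (λ h → pathsᴿ j h * trimmedᴿ i h)
            ≈⟨ sym (+-cong (reflexive (trimmedWith-< powers i j j<K))
                           (∑-cong j {g = λ h → pathsᴿ j h * trimmedᴿ i h} (λ h h<j → *-cong (reflexive (mixCols-< (suc k) j pathsᵀ (λ _ _ → 0#) h j<K))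
                                                        (reflexive (trimmedWith-< powers i h (ℕₚ.<-trans h<j j<K)))))) ⟩
              N i j + ∑ j (λ h → U h j * N i h)
            ∎
          ... | inj₂ ≡.refl = begin
              hankelᴹ i (suc k)
            ≡⟨ mixCols-≥ (suc k) (suc k) (λ i j → fromℕ R (aSeq k (i ℕ.+ j))) (λ i _ → powers i) i ℕₚ.≤-refl ⟩
              powers i
            ≈⟨ sym (trans (+-congˡ (∑-zero (suc k) {λ h → U h (suc k) * N i h} (λ h _ → trans (*-congʳ (reflexive (mixCols-≥ (suc k) (suc k) pathsᵀ (λ _ _ → 0#) h ℕₚ.≤-refl))) (zeroˡ _))))
                          (trans (+-identityʳ _) (reflexive (trimmedWith-last powers i)))) ⟩
              N i (suc k) + ∑ (suc k) (λ h → U h (suc k) * N i h)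
            ∎

      det-trimmedWith-powers≈residual : det′ (suc (suc k)) (trimmedWith powers) ≈ det′ (suc (suc k)) (trimmedWith residual)
      det-trimmedWith-powers≈residual = det′-unitriangularColOps (suc (suc k)) (trimmedWith residual) (trimmedWith powers) U columns
        where
          dualCol : Matrix
          dualCol h _ = dual (suc k) h
          U : Matrix
          U = mixCols (suc k) (λ _ _ → 0#) dualCol
          columns : ∀ i j → i < suc (suc k) → j < suc (suc k) →
                    trimmedWith powers i j ≈ trimmedWith residual i j + ∑ j (λ h → U h j * trimmedWith residual i h)
          columns i j _ j<n with ℕₚ.m<1+n⇒m<n∨m≡n j<n
          ... | inj₁ j<K = begin
              trimmedWith powers i j
            ≡⟨ ≡.trans (trimmedWith-< powers i j j<K) (≡.sym (trimmedWith-< residual i j j<K)) ⟩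
              trimmedWith residual i j
            ≈⟨ sym (trans (+-congˡ (∑-zero j (λ h _ → trans (*-congʳ (reflexive (mixCols-< (suc k) j (λ _ _ → 0#) dualCol h j<K))) (zeroˡ _)))) (+-identityʳ _)) ⟩
              trimmedWith residual i j + ∑ j (λ h → U h j * trimmedWith residual i h)
            ∎
          ... | inj₂ ≡.refl = begin
              trimmedWith powers i (suc k)
            ≡⟨ trimmedWith-last powers i ⟩
              powers i
            ≈⟨ sym (//-rightDividesˡ (∑ (suc k) (λ h → dual (suc k) h * trimmedᴿ i h)) (powers i)) ⟩
              residual i + ∑ (suc k) (λ h → dual (suc k) h * trimmedᴿ i h)
            ≈⟨ sym (+-cong (reflexive (trimmedWith-last residual i))
                           (∑-cong (suc k) {g = λ h → dual (suc k) h * trimmedᴿ i h} (λ h h<K → *-cong (reflexive (mixCols-≥ (suc k) (suc k) (λ _ _ → 0#) dualCol h ℕₚ.≤-refl))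
                                                              (reflexive (trimmedWith-< residual i h h<K))))) ⟩
              trimmedWith residual i (suc k) + ∑ (suc k) (λ h → U h (suc k) * trimmedWith residual i h)
            ∎

      det-trimmedWith-residual : det′ (suc (suc k)) (trimmedWith residual) ≈ residual (suc k)
      det-trimmedWith-residual = begin
          det′ (suc (suc k)) (trimmedWith residual)
        ≈⟨ det′-lowerTriangular (suc (suc k)) (trimmedWith residual) upper ⟩
          ∏ (suc (suc k)) (λ i → trimmedWith residual i i)
        ≈⟨ ∏-last (suc k) (λ i → trimmedWith residual i i) diagonal ⟩
          trimmedWith residual (suc k) (suc k)
        ≡⟨ trimmedWith-last residual (suc k) ⟩
          residual (suc k)
        ∎
        where
          upper : ∀ i j → i < j → j < suc (suc k) → trimmedWith residual i j ≈ 0#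
          upper i j i<j j<n with ℕₚ.m<1+n⇒m<n∨m≡n j<n
          ... | inj₁ j<K    = trans (reflexive (trimmedWith-< residual i j j<K))
                                    (fromℕ-≡ (trimmedPaths-upper k i j i<j))
          ... | inj₂ ≡.refl = trans (reflexive (trimmedWith-last residual i))
                                    (residual-vanishes i i<j)
          diagonal : ∀ i → i < suc k → trimmedWith residual i i ≈ 1#
          diagonal i i<K = trans (reflexive (trimmedWith-< residual i i i<K))
                                 (trans (fromℕ-≡ (trimmedPaths-row k i i (λ i≡K → ℕₚ.<-irrefl i≡K i<K))) (pathsᴿ-diag i))

      lucas≈det-hankel : Lucas R (suc k) 1# (- (x * x)) ≈ det R (suc (suc k)) (hankel R k x)
      lucas≈det-hankel = sym (begin
          det′ (suc (suc k)) hankelᴹ                ≈⟨ det-hankel≈trimmedWith-powers ⟩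
          det′ (suc (suc k)) (trimmedWith powers)   ≈⟨ det-trimmedWith-powers≈residual ⟩
          det′ (suc (suc k)) (trimmedWith residual) ≈⟨ det-trimmedWith-residual ⟩
          residual (suc k)                          ≈⟨ residual-last ⟩
          ρ (suc k) + x * ρ k                       ≈⟨ sym lucas≈ρ ⟩
          Lucas R (suc k) 1# (- (x * x))            ∎)

proposition4 : ∀ {c ℓ} (R : CommutativeRing c ℓ) (k : ℕ) → 1 ≤ k →
    (x : CommutativeRing.Carrier R) →
    let open CommutativeRing R in
    Lucas R (suc k) 1# (- (x * x)) ≈ det R (suc (suc k)) (hankel R k x)
-- the identity holds for k = 0 as well
proposition4 R k _ x = HankelLucas.lucas≈det-hankel R x k
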